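{- Let $m,n$ be positive integers, let $K$ be an arbitrary field, and let $c=\gcd(m+1,n+1)-1$. For the $m\times n$ rectangular graph $G$ with black-to-white adjacency map $BW_K$ and white-to-black adjacency map $\mathit{WB}_K$ over $K$, we have $$\dim_K \ker BW_K=\lceil c/2\rceil,\qquad \dim_K\ker \mathit{WB}_K=\lfloor c/2\rfloor .$$ Moreover, each of these two kernels has a basis consisting of vectors all of whose coordinates belong to $\{0,1,-1\}$.
   Context: The $m\times n$ rectangular graph is $G=\{(x,y)\in\mathbb{Z}^2: 0\le x\le m-1,\ 0\le y\le n-1\}$, where two points are adjacent iff they differ by exactly $1$ in exactly one coordinate. A point $(x,y)$ is black if $x+y$ is even and white if $x+y$ is odd (so the origin is black). Let $K^{\mathrm{black}}$ (resp. $K^{\mathrm{white}}$) be the space of $K$-valued functions on the black (resp. white) points of $G$. The black-to-white adjacency map $BW_K:K^{\mathrm{black}}\to K^{\mathrm{white}}$ is $(BW_K v)(w)=\sum v(b)$, the sum over the black points $b$ adjacent to $w$; i.e. its matrix (rows indexed by white points, columns by black points) has entry $1$ if the points are adjacent and $0$ otherwise. The white-to-black adjacency map $\mathit{WB}_K:K^{\mathrm{white}}\to K^{\mathrm{black}}$ is defined analogously. -}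

module Defs where

open import Level using (Level; _⊔_; suc)
open import Algebra.Bundles using (CommutativeRing)
open import Data.Nat as ℕ using (ℕ; zero; suc; ∣_-_∣; _≡ᵇ_)
open import Data.Fin using (Fin; toℕ)
open import Data.Bool using (Bool; true; false; not; if_then_else_; T)
open import Data.Product using (Σ; ∃; _×_; _,_)
open import Data.Sum using (_⊎_)
open import Relation.Nullary using (¬_; yes; no)
open import Relation.Nullary.Decidable using (T?)

record Field (c ℓ : Level) : Set (Level.suc (c ⊔ ℓ)) where
  field
    commutativeRing : CommutativeRing c ℓ
  open CommutativeRing commutativeRing public
  field
    1≉0     : ¬ (1# ≈ 0#)
    inverse : ∀ x → ¬ (x ≈ 0#) → Σ Carrier (λ y → x * y ≈ 1#)

even : ℕ → Bool
even zero          = true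
even (suc zero)    = false
even (suc (suc k)) = even k

Point : ℕ → ℕ → Set
Point m n = Fin m × Fin n

isBlack : ∀ {m n} → Point m n → Bool
isBlack (x , y) = even (toℕ x ℕ.+ toℕ y)

-- Black / white points (the T-proof is proof-irrelevant: T b is ⊤ or ⊥).
BlackPt : ℕ → ℕ → Set
BlackPt m n = Σ (Point m n) (λ p → T (isBlack p))

WhitePt : ℕ → ℕ → Set
WhitePt m n = Σ (Point m n) (λ p → T (not (isBlack p)))

adjacent : ∀ {m n} → Point m n → Point m n → Bool
adjacent (x , y) (x' , y') = (∣ toℕ x - toℕ x' ∣ ℕ.+ ∣ toℕ y - toℕ y' ∣) ≡ᵇ 1

module Linear {c ℓ : Level} (K : Field c ℓ) where
  open Field K

  sumFin : (k : ℕ) → (Fin k → Carrier) → Carrier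
  sumFin zero    f = 0#
  sumFin (suc k) f = f Fin.zero + sumFin k (λ i → f (Fin.suc i))

  sumGrid : (m n : ℕ) → (Point m n → Carrier) → Carrier
  sumGrid m n f = sumFin m (λ x → sumFin n (λ y → f (x , y)))

  extB : ∀ {m n} → (BlackPt m n → Carrier) → Point m n → Carrier
  extB {m} {n} v p with T? (isBlack p)
  ... | yes b = v (p , b)
  ... | no _  = 0#

  extW : ∀ {m n} → (WhitePt m n → Carrier) → Point m n → Carrier
  extW {m} {n} v p with T? (not (isBlack p))
  ... | yes w = v (p , w)
  ... | no _  = 0#

  BW : ∀ {m n} → (BlackPt m n → Carrier) → (WhitePt m n → Carrier)
  BW {m} {n} v (w , _) = sumGrid m n (λ p → if adjacent p w then extB v p else 0#)

  WB : ∀ {m n} → (WhitePt m n → Carrier) → (BlackPt m n → Carrier)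
  WB {m} {n} u (b , _) = sumGrid m n (λ p → if adjacent p b then extW u p else 0#)

  KerBW : ∀ {m n} → (BlackPt m n → Carrier) → Set ℓ
  KerBW {m} {n} v = ∀ w → BW v w ≈ 0#

  KerWB : ∀ {m n} → (WhitePt m n → Carrier) → Set ℓ
  KerWB {m} {n} u = ∀ b → WB u b ≈ 0#

  module _ {I : Set} where
    linComb : {d : ℕ} → (Fin d → Carrier) → (Fin d → I → Carrier) → I → Carrier
    linComb {d} a vs i = sumFin d (λ j → a j * vs j i)

    LinIndep : {d : ℕ} → (Fin d → I → Carrier) → Set (c ⊔ ℓ)
    LinIndep {d} vs = ∀ (a : Fin d → Carrier) →
      (∀ i → linComb a vs i ≈ 0#) → ∀ j → a j ≈ 0#

    Spans : ∀ {ℓ'} → (S : (I → Carrier) → Set ℓ') → {d : ℕ} →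
            (Fin d → I → Carrier) → Set (c ⊔ ℓ ⊔ ℓ')
    Spans S {d} vs = ∀ v → S v → Σ (Fin d → Carrier) (λ a → ∀ i → v i ≈ linComb a vs i)

    IsBasis : ∀ {ℓ'} → (S : (I → Carrier) → Set ℓ') → {d : ℕ} →
              (Fin d → I → Carrier) → Set (c ⊔ ℓ ⊔ ℓ')
    IsBasis S vs = (∀ j → S (vs j)) × LinIndep vs × Spans S vs

    HasDim : ∀ {ℓ'} → (S : (I → Carrier) → Set ℓ') → ℕ → Set (c ⊔ ℓ ⊔ ℓ')
    HasDim S d = Σ (Fin d → I → Carrier) (λ vs → IsBasis S vs)

    HasSignBasis : ∀ {ℓ'} → (S : (I → Carrier) → Set ℓ') → Set (c ⊔ ℓ ⊔ ℓ')
    HasSignBasis S = Σ ℕ (λ d → Σ (Fin d → I → Carrier) (λ vs →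
      IsBasis S vs × (∀ j i → (vs j i ≈ 0#) ⊎ (vs j i ≈ 1#) ⊎ (vs j i ≈ - 1#))))

module Submission where

-- Put grid point (x , y) at (x + 1 , y + 1) of the frame [0, m + 1] × [0, n + 1] and extend a kernel
-- vector by zero. The kernel condition says that the extension φ is harmonic (the four neighbours of
-- each interior point sum to 0) and vanishes on the other colour class. Row Y + 2 of φ is forced by
-- rows Y and Y + 1, so φ is determined by its first row h. Extending h to an odd 2p-periodic function
-- R on ℤ (p = m + 1), the rows of φ extend to a discrete wave w generated by R, whose rows satisfy
-- w Y (z + 1) − w Y (z − 1) = ± (R (z + Y) − R (z − Y)). Since the top row vanishes, R is also
-- 2q-periodic (q = n + 1), hence 2d-periodic for d = gcd p q, and R vanishes at d because p or q is
-- an odd multiple of d. So φ is determined by h 1, …, h (d − 1), and only the entries of the right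
-- colour can be nonzero. Conversely, for each such entry j + 1 the alternating d'Alembert solution
-- g (X + Y) − g (X − Y), where g is the even 2d-periodic indicator of distance ≥ j + 2 from 2dℤ, is a
-- kernel vector with entries in {0, 1, −1} whose first row is the indicator of j + 1. Nothing is ever
-- inverted, so the argument works over any commutative ring.

open import Level using (Level)
open import Algebra.Bundles using (CommutativeRing)
open import Algebra.Solver.Ring.AlmostCommutativeRing using (fromCommutativeRing; _-Raw-AlmostCommutative⟶_)
open import Data.Bool using (Bool; true; false; not; if_then_else_; T)
open import Data.Bool.Properties using (T-irrelevant; T-≡; T-not-≡; not-injective)
open import Data.Empty using (⊥-elim)
open import Data.Fin as Fin using (Fin; toℕ; fromℕ<)
import Data.Fin.Properties as Fin
open import Data.Integer as ℤ using (ℤ; +_; -[1+_]; 0ℤ; 1ℤ; _⊖_)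
import Data.Integer.Properties as ℤ
open import Data.Integer.DivMod using (_%ℕ_; _/ℕ_; a≡a%ℕn+[a/ℕn]*n; n%ℕd<d)
import Data.Integer.Divisibility.Signed as ℤ∣
open import Data.Integer.Divisibility.Signed using (∣⇒∣ᵤ)
open import Data.Integer.Tactic.RingSolver using () renaming (solve-∀ to solve-ℤ)
open import Data.Maybe using (Maybe; just; nothing)
open import Data.Nat as ℕ using (ℕ; zero; suc; _<_; _≤_; z≤n; s≤s; NonZero; _<?_; _≤?_; _≡ᵇ_; ∣_-_∣; ⌊_/2⌋; ⌈_/2⌉)
import Data.Nat.Properties as ℕ
open import Data.Nat.DivMod using (m<n⇒m%n≡m)
open import Data.Nat.Divisibility using (_∣_; _∣?_; divides; ∣-refl; ∣⇒≤)
open import Data.Nat.GCD using (gcd; gcd-GCD; module Bézout; gcd[m,n]∣m; gcd[m,n]∣n; gcd[m,n]≢0; gcd-greatest; c*gcd[m,n]≡gcd[cm,cn])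
open import Data.Nat.Tactic.RingSolver using () renaming (solve-∀ to solve-ℕ)
open import Data.Product using (Σ; ∃; _,_; proj₁; proj₂)
open import Data.Sign as Sign using (Sign)
open import Data.Sum as ⊎ using (_⊎_; inj₁; inj₂)
open import Function using (_∘_; id)
open import Function.Bundles using (Equivalence)
open import Relation.Binary.Definitions using (tri<; tri≈; tri>)
open import Relation.Binary.PropositionalEquality as ≡ using (_≡_; _≢_; cong; cong₂)
open import Relation.Nullary using (¬_; Dec; yes; no; contradiction)
open import Relation.Nullary.Decidable using (T?)
open import Defs

module Residue (M : ℕ) .{{_ : NonZero M}} where

  residue : ℤ → ℕ
  residue z = z %ℕ M

  private
    multiple-of-M-below-M : ∀ {u v} → u < v → v < M → ¬ (M ∣ ℤ.∣ u ⊖ v ∣)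
    multiple-of-M-below-M {u} {v} u<v v<M M∣u⊖v = ℕ.<⇒≱ v<M (begin
      M               ≤⟨ ∣⇒≤ {{ℕ.>-nonZero (ℕ.m<n⇒0<n∸m u<v)}} (≡.subst (M ∣_) (ℤ.∣⊖∣-< u<v) M∣u⊖v) ⟩
      v ℕ.∸ u         ≤⟨ ℕ.m∸n≤m v u ⟩
      v               ∎)
      where open ℕ.≤-Reasoning

    residues-equal : ∀ u v (k : ℤ) → u < M → v < M → + u ℤ.- + v ≡ k ℤ.* + M → u ≡ v
    residues-equal u v k u<M v<M eq with ℕ.<-cmp u v
    ... | tri≈ _ u≡v _ = u≡v
    ... | tri< u<v _ _ = contradiction M∣u⊖v (multiple-of-M-below-M u<v v<M)
      where M∣u⊖v = ≡.subst (λ t → M ∣ ℤ.∣ t ∣) (ℤ.m-n≡m⊖n u v) (∣⇒∣ᵤ (ℤ∣.divides k eq))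
    ... | tri> _ _ v<u = contradiction M∣v⊖u (multiple-of-M-below-M v<u u<M)
      where M∣v⊖u = ≡.subst (M ∣_) (≡.trans (cong ℤ.∣_∣ (ℤ.m-n≡m⊖n u v)) (ℤ.∣m⊖n∣≡∣n⊖m∣ u v))
                      (∣⇒∣ᵤ (ℤ∣.divides k eq))

  residue-unique : ∀ z u (k : ℤ) → u < M → z ≡ + u ℤ.+ k ℤ.* + M → residue z ≡ u
  residue-unique z u k u<M z≡u+kM = ≡.sym (residues-equal u r (z /ℕ M ℤ.- k) u<M (n%ℕd<d z M) u-r≡[q-k]M)
    where
    open ≡.≡-Reasoning
    r = residue z
    rearrange : ∀ u r k M → u ℤ.- r ≡ ((u ℤ.+ k ℤ.* M) ℤ.- r) ℤ.- k ℤ.* M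
    rearrange = solve-ℤ
    collect : ∀ r k q M → ((r ℤ.+ q ℤ.* M) ℤ.- r) ℤ.- k ℤ.* M ≡ (q ℤ.- k) ℤ.* M
    collect = solve-ℤ
    u-r≡[q-k]M : + u ℤ.- + r ≡ (z /ℕ M ℤ.- k) ℤ.* + M
    u-r≡[q-k]M = begin
      + u ℤ.- + r                                         ≡⟨ rearrange (+ u) (+ r) k (+ M) ⟩
      ((+ u ℤ.+ k ℤ.* + M) ℤ.- + r) ℤ.- k ℤ.* + M         ≡⟨ cong (λ t → (t ℤ.- + r) ℤ.- k ℤ.* + M)
                                                               (≡.trans (≡.sym z≡u+kM) (a≡a%ℕn+[a/ℕn]*n z M)) ⟩
      ((+ r ℤ.+ z /ℕ M ℤ.* + M) ℤ.- + r) ℤ.- k ℤ.* + M    ≡⟨ collect (+ r) k (z /ℕ M) (+ M) ⟩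
      (z /ℕ M ℤ.- k) ℤ.* + M                              ∎

  residue-small : ∀ {a} → a < M → residue (+ a) ≡ a
  residue-small = m<n⇒m%n≡m

  residue-periodic : ∀ z → residue (z ℤ.+ + M) ≡ residue z
  residue-periodic z = residue-unique (z ℤ.+ + M) (residue z) (z /ℕ M ℤ.+ 1ℤ) (n%ℕd<d z M)
    (≡.trans (cong (ℤ._+ + M) (a≡a%ℕn+[a/ℕn]*n z M)) (shift (+ residue z) (z /ℕ M) (+ M)))
    where
    shift : ∀ r q M → (r ℤ.+ q ℤ.* M) ℤ.+ M ≡ r ℤ.+ (q ℤ.+ 1ℤ) ℤ.* M
    shift = solve-ℤ

  residue-neg-zero : ∀ z → residue z ≡ 0 → residue (ℤ.- z) ≡ 0
  residue-neg-zero z r≡0 = residue-unique (ℤ.- z) 0 (ℤ.- (z /ℕ M)) (ℕ.>-nonZero⁻¹ M)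
    (≡.trans (cong ℤ.-_ (≡.trans (a≡a%ℕn+[a/ℕn]*n z M) (cong (λ r → + r ℤ.+ z /ℕ M ℤ.* + M) r≡0)))
             (negate (z /ℕ M) (+ M)))
    where
    negate : ∀ q M → ℤ.- (0ℤ ℤ.+ q ℤ.* M) ≡ 0ℤ ℤ.+ (ℤ.- q) ℤ.* M
    negate = solve-ℤ

  residue-neg-suc : ∀ z {u} → residue z ≡ suc u → residue (ℤ.- z) ≡ M ℕ.∸ residue z
  residue-neg-suc z {u} r≡1+u = residue-unique (ℤ.- z) (M ℕ.∸ r) (ℤ.- (z /ℕ M) ℤ.- 1ℤ)
    (ℕ.∸-monoʳ-< (≡.subst (0 <_) (≡.sym r≡1+u) (s≤s z≤n)) (ℕ.<⇒≤ r<M))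
    (begin
      ℤ.- z                                          ≡⟨ cong ℤ.-_ (a≡a%ℕn+[a/ℕn]*n z M) ⟩
      ℤ.- (+ r ℤ.+ q ℤ.* + M)                        ≡⟨ reflect (+ r) q (+ M) ⟩
      (+ M ℤ.- + r) ℤ.+ (ℤ.- q ℤ.- 1ℤ) ℤ.* + M       ≡⟨ cong (ℤ._+ (ℤ.- q ℤ.- 1ℤ) ℤ.* + M)
                                                          (≡.trans (ℤ.m-n≡m⊖n M r) (ℤ.⊖-≥ (ℕ.<⇒≤ r<M))) ⟩
      + (M ℕ.∸ r) ℤ.+ (ℤ.- q ℤ.- 1ℤ) ℤ.* + M         ∎)
    where
    open ≡.≡-Reasoning
    r = residue z
    q = z /ℕ M
    r<M = n%ℕd<d z M
    reflect : ∀ r q M → ℤ.- (r ℤ.+ q ℤ.* M) ≡ (M ℤ.- r) ℤ.+ (ℤ.- q ℤ.- 1ℤ) ℤ.* M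
    reflect = solve-ℤ

even-suc : ∀ k → even (suc k) ≡ not (even k)
even-suc zero          = ≡.refl
even-suc (suc zero)    = ≡.refl
even-suc (suc (suc k)) = even-suc k

even-+-double : ∀ a b → even (a ℕ.+ (b ℕ.+ b)) ≡ even a
even-+-double a zero    = cong even (ℕ.+-identityʳ a)
even-+-double a (suc b) = ≡.trans (cong even (shift a b)) (even-+-double a b)
  where
  shift : ∀ a b → a ℕ.+ (suc b ℕ.+ suc b) ≡ suc (suc (a ℕ.+ (b ℕ.+ b)))
  shift = solve-ℕ

even-suc-double : ∀ h → even (suc (h ℕ.+ h)) ≡ false
even-suc-double h = ≡.trans (even-suc (h ℕ.+ h)) (cong not (even-+-double 0 h))

halve : ∀ x → ∃ λ k → x ≡ k ℕ.+ k ⊎ x ≡ suc (k ℕ.+ k)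
halve zero = 0 , inj₁ ≡.refl
halve (suc x) with halve x
... | k , inj₁ x≡k+k   = k , inj₂ (cong suc x≡k+k)
... | k , inj₂ x≡1+k+k = suc k , inj₁ (cong suc (≡.trans x≡1+k+k (≡.sym (ℕ.+-suc k k))))

record BandIndexing (e d k : ℕ) : Set where
  field
    index             : Fin k → ℕ
    index-injective   : ∀ {i i′} → index i ≡ index i′ → i ≡ i′
    index-parity      : ∀ i → even (index i ℕ.+ e) ≡ true
    index-bound       : ∀ i → suc (index i) < d
    index-surjective  : ∀ x → suc x < d → even (x ℕ.+ e) ≡ true → Σ (Fin k) (λ i → index i ≡ x)

<⌊/2⌋⇒ : ∀ i t → i < ⌊ t /2⌋ → suc (suc (i ℕ.+ i)) ≤ t
<⌊/2⌋⇒ i t i<t/2 = begin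
  suc (suc (i ℕ.+ i))      ≡⟨ cong suc (ℕ.+-suc i i) ⟨
  suc i ℕ.+ suc i          ≤⟨ ℕ.+-mono-≤ i<t/2 (ℕ.≤-trans i<t/2 (ℕ.⌊n/2⌋≤⌈n/2⌉ t)) ⟩
  ⌊ t /2⌋ ℕ.+ ⌈ t /2⌉      ≡⟨ ℕ.⌊n/2⌋+⌈n/2⌉≡n t ⟩
  t                        ∎
  where open ℕ.≤-Reasoning

<⌊/2⌋⇐ : ∀ i t → suc (suc (i ℕ.+ i)) ≤ t → i < ⌊ t /2⌋
<⌊/2⌋⇐ i t 2+2i≤t = ≡.subst (_≤ ⌊ t /2⌋) (cong suc (≡.sym (ℕ.n≡⌊n+n/2⌋ i))) (ℕ.⌊n/2⌋-mono 2+2i≤t)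

parity-decomposition : ∀ {x e} → e ≤ 1 → even (x ℕ.+ e) ≡ true → ∃ λ h → x ≡ h ℕ.+ h ℕ.+ e
parity-decomposition {x} {e} e≤1 x+e-even with halve x | e≤1
... | h , inj₁ ≡.refl | z≤n     = h , ≡.sym (ℕ.+-identityʳ _)
... | h , inj₂ ≡.refl | s≤s z≤n = h , ℕ.+-comm 1 (h ℕ.+ h)
... | h , inj₂ ≡.refl | z≤n     =
  contradiction (≡.trans (≡.sym x+e-even) (≡.trans (cong even (ℕ.+-identityʳ (suc (h ℕ.+ h)))) (even-suc-double h))) λ ()
... | h , inj₁ ≡.refl | s≤s z≤n =
  contradiction (≡.trans (≡.sym x+e-even) (≡.trans (cong even (ℕ.+-comm (h ℕ.+ h) 1)) (even-suc-double h))) λ ()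

bandIndexing : ∀ {e t d} → e ≤ 1 → t ℕ.+ e ≡ d → BandIndexing e d ⌊ t /2⌋
bandIndexing {e} {t} e≤1 ≡.refl = record
  { index            = index
  ; index-injective  = λ {i} {i′} eq → Fin.toℕ-injective (halves-equal (ℕ.+-cancelʳ-≡ e _ _ eq))
  ; index-parity     = λ i → ≡.trans (cong even (regroup (toℕ i) e)) (even-+-double 0 (toℕ i ℕ.+ e))
  ; index-bound      = λ i → ℕ.+-monoˡ-≤ e (<⌊/2⌋⇒ (toℕ i) t (Fin.toℕ<n i))
  ; index-surjective = surjective
  }
  where
  index : Fin ⌊ t /2⌋ → ℕ
  index i = toℕ i ℕ.+ toℕ i ℕ.+ e
  halves-equal : ∀ {a b} → a ℕ.+ a ≡ b ℕ.+ b → a ≡ b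
  halves-equal {a} {b} eq = ≡.trans (ℕ.n≡⌊n+n/2⌋ a) (≡.trans (cong ⌊_/2⌋ eq) (≡.sym (ℕ.n≡⌊n+n/2⌋ b)))
  regroup : ∀ a e → a ℕ.+ a ℕ.+ e ℕ.+ e ≡ 0 ℕ.+ ((a ℕ.+ e) ℕ.+ (a ℕ.+ e))
  regroup = solve-ℕ
  surjective : ∀ x → suc x < t ℕ.+ e → even (x ℕ.+ e) ≡ true → Σ (Fin ⌊ t /2⌋) (λ i → index i ≡ x)
  surjective x 1+x<t+e x+e-even with parity-decomposition {x} e≤1 x+e-even
  ... | h , ≡.refl = fromℕ< h<t/2 , cong (λ a → a ℕ.+ a ℕ.+ e) (Fin.toℕ-fromℕ< h<t/2)
    where h<t/2 = <⌊/2⌋⇐ h t (ℕ.+-cancelʳ-≤ e _ _ 1+x<t+e)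

-- Algebra.Solver.Ring needs a coefficient ring mapping into the carrier; ℤ maps into every ring.
module IntegerCoefficients {c ℓ : Level} (R : CommutativeRing c ℓ) where
  open CommutativeRing R
  open import Algebra.Properties.Ring ring
  open import Algebra.Properties.Semiring.Mult semiring
  open import Relation.Binary.Reasoning.Setoid setoid

  fromℤ : ℤ → Carrier
  fromℤ (+ n)     = n × 1#
  fromℤ -[1+ n ] = - (suc n × 1#)

  private
    signed : Sign → Carrier → Carrier
    signed Sign.+ x = x
    signed Sign.- x = - x

    signed-cong : ∀ s {x y} → x ≈ y → signed s x ≈ signed s y
    signed-cong Sign.+ = λ e → e
    signed-cong Sign.- = -‿cong

    signed-* : ∀ s t x y → signed (s Sign.* t) (x * y) ≈ signed s x * signed t y
    signed-* Sign.+ Sign.+ x y = refl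
    signed-* Sign.+ Sign.- x y = -‿distribʳ-* x y
    signed-* Sign.- Sign.+ x y = -‿distribˡ-* x y
    signed-* Sign.- Sign.- x y = begin
      x * y         ≈⟨ -‿involutive (x * y) ⟨
      - - (x * y)   ≈⟨ -‿cong (-‿distribʳ-* x y) ⟩
      - (x * - y)   ≈⟨ -‿distribˡ-* x (- y) ⟩
      - x * - y     ∎

    fromℤ-◃ : ∀ s n → fromℤ (s ℤ.◃ n) ≈ signed s (n × 1#)
    fromℤ-◃ Sign.+ zero    = refl
    fromℤ-◃ Sign.- zero    = sym -0#≈0#
    fromℤ-◃ Sign.+ (suc n) = refl
    fromℤ-◃ Sign.- (suc n) = refl

    fromℤ-sign-abs : ∀ i → fromℤ i ≈ signed (ℤ.sign i) (ℤ.∣ i ∣ × 1#)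
    fromℤ-sign-abs (+ zero)  = refl
    fromℤ-sign-abs (+ suc n) = refl
    fromℤ-sign-abs -[1+ n ]  = refl

    fromℤ-⊖ : ∀ m n → fromℤ (m ⊖ n) ≈ m × 1# - n × 1#
    fromℤ-⊖ zero    zero    = sym (trans (+-congˡ -0#≈0#) (+-identityʳ 0#))
    fromℤ-⊖ (suc m) zero    = sym (trans (+-congˡ -0#≈0#) (+-identityʳ _))
    fromℤ-⊖ zero    (suc n) = sym (+-identityˡ _)
    fromℤ-⊖ (suc m) (suc n) = begin
      fromℤ (suc m ⊖ suc n)           ≡⟨ ≡.cong fromℤ (ℤ.[1+m]⊖[1+n]≡m⊖n m n) ⟩
      fromℤ (m ⊖ n)                   ≈⟨ fromℤ-⊖ m n ⟩
      m × 1# - n × 1#                 ≈⟨ cancel (m × 1#) (n × 1#) ⟩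
      (1# + m × 1#) - (1# + n × 1#)   ∎
      where
      cancel : ∀ a b → a - b ≈ (1# + a) - (1# + b)
      cancel a b = sym (begin
        (1# + a) + - (1# + b)    ≈⟨ +-congˡ (-‿+-comm 1# b) ⟨
        (1# + a) + (- 1# + - b)  ≈⟨ +-assoc 1# a _ ⟩
        1# + (a + (- 1# + - b))  ≈⟨ +-congˡ (+-assoc a (- 1#) (- b)) ⟨
        1# + ((a + - 1#) + - b)  ≈⟨ +-congˡ (+-congʳ (+-comm a (- 1#))) ⟩
        1# + ((- 1# + a) + - b)  ≈⟨ +-congˡ (+-assoc (- 1#) a (- b)) ⟩
        1# + (- 1# + (a + - b))  ≈⟨ +-assoc 1# (- 1#) _ ⟨
        (1# + - 1#) + (a + - b)  ≈⟨ +-congʳ (-‿inverseʳ 1#) ⟩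
        0# + (a + - b)           ≈⟨ +-identityˡ _ ⟩
        a + - b                  ∎)

  fromℤ-neg : ∀ i → fromℤ (ℤ.- i) ≈ - fromℤ i
  fromℤ-neg (+ zero)  = sym -0#≈0#
  fromℤ-neg (+ suc n) = refl
  fromℤ-neg -[1+ n ]  = sym (-‿involutive _)

  fromℤ-+ : ∀ i j → fromℤ (i ℤ.+ j) ≈ fromℤ i + fromℤ j
  fromℤ-+ (+ m)    (+ n)    = ×-homo-+ 1# m n
  fromℤ-+ (+ m)    -[1+ n ] = fromℤ-⊖ m (suc n)
  fromℤ-+ -[1+ m ] (+ n)    = trans (fromℤ-⊖ n (suc m)) (+-comm _ _)
  fromℤ-+ -[1+ m ] -[1+ n ] = begin
    - (suc (suc (m ℕ.+ n)) × 1#)     ≡⟨ ≡.cong (λ k → - (suc k × 1#)) (ℕ.+-suc m n) ⟨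
    - ((suc m ℕ.+ suc n) × 1#)       ≈⟨ -‿cong (×-homo-+ 1# (suc m) (suc n)) ⟩
    - (suc m × 1# + suc n × 1#)      ≈⟨ -‿+-comm _ _ ⟨
    - (suc m × 1#) + - (suc n × 1#)  ∎

  fromℤ-* : ∀ i j → fromℤ (i ℤ.* j) ≈ fromℤ i * fromℤ j
  fromℤ-* i j = begin
    fromℤ (i ℤ.* j)                         ≈⟨ fromℤ-◃ (s Sign.* t) (ℤ.∣ i ∣ ℕ.* ℤ.∣ j ∣) ⟩
    signed (s Sign.* t) ((ℤ.∣ i ∣ ℕ.* ℤ.∣ j ∣) × 1#)
                                            ≈⟨ signed-cong (s Sign.* t) (×1-homo-* ℤ.∣ i ∣ ℤ.∣ j ∣) ⟩
    signed (s Sign.* t) ((ℤ.∣ i ∣ × 1#) * (ℤ.∣ j ∣ × 1#))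
                                            ≈⟨ signed-* s t _ _ ⟩
    signed s (ℤ.∣ i ∣ × 1#) * signed t (ℤ.∣ j ∣ × 1#)
                                            ≈⟨ *-cong (fromℤ-sign-abs i) (fromℤ-sign-abs j) ⟨
    fromℤ i * fromℤ j                       ∎
    where s = ℤ.sign i; t = ℤ.sign j

  fromℤ-morphism : ℤ.+-*-rawRing -Raw-AlmostCommutative⟶ fromCommutativeRing R
  fromℤ-morphism = record
    { ⟦_⟧    = fromℤ
    ; +-homo = fromℤ-+
    ; *-homo = fromℤ-*
    ; -‿homo = fromℤ-neg
    ; 0-homo = refl
    ; 1-homo = +-identityʳ 1#
    }

  fromℤ-≟ : ∀ i j → Maybe (fromℤ i ≈ fromℤ j)
  fromℤ-≟ i j with i ℤ.≟ j
  ... | yes ≡.refl = just refl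
  ... | no _       = nothing

  open import Algebra.Solver.Ring ℤ.+-*-rawRing (fromCommutativeRing R)
    fromℤ-morphism fromℤ-≟ public

module PeriodicFunctions {c ℓ : Level} (R : CommutativeRing c ℓ) where
  open CommutativeRing R
  open import Algebra.Properties.Ring ring using (-0#≈0#)
  open import Relation.Binary.Reasoning.Setoid setoid

  Periodic : (ℤ → Carrier) → ℕ → Set ℓ
  Periodic W M = ∀ z → W (z ℤ.+ + M) ≈ W z

  SymmetricAbout : (Carrier → Carrier) → ℤ → (ℤ → Carrier) → Set ℓ
  SymmetricAbout s a W = ∀ z → W (a ℤ.- z) ≈ s (W (a ℤ.+ z))

  module _ {W : ℤ → Carrier} {M : ℕ} (W-periodic : Periodic W M) where

    periodic-multiple : ∀ k z → W (z ℤ.+ + (k ℕ.* M)) ≈ W z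
    periodic-multiple zero    z = reflexive (cong W (ℤ.+-identityʳ z))
    periodic-multiple (suc k) z = begin
      W (z ℤ.+ (+ M ℤ.+ + (k ℕ.* M)))   ≡⟨ cong W (shift z (+ M) (+ (k ℕ.* M))) ⟩
      W ((z ℤ.+ + (k ℕ.* M)) ℤ.+ + M)   ≈⟨ W-periodic _ ⟩
      W (z ℤ.+ + (k ℕ.* M))             ≈⟨ periodic-multiple k z ⟩
      W z                               ∎
      where
      shift : ∀ z a b → z ℤ.+ (a ℤ.+ b) ≡ (z ℤ.+ b) ℤ.+ a
      shift = solve-ℤ

    periodic-∣ : ∀ {N} → M ∣ N → Periodic W N
    periodic-∣ (divides k ≡.refl) = periodic-multiple k

    periodic-ℤ-multiple : ∀ k z → W (z ℤ.+ k ℤ.* + M) ≈ W z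
    periodic-ℤ-multiple (+ k) z = begin
      W (z ℤ.+ + k ℤ.* + M)   ≡⟨ cong (λ t → W (z ℤ.+ t)) (≡.sym (ℤ.pos-* k M)) ⟩
      W (z ℤ.+ + (k ℕ.* M))   ≈⟨ periodic-multiple k z ⟩
      W z                     ∎
    periodic-ℤ-multiple -[1+ k ] z = begin
      W (z ℤ.+ -[1+ k ] ℤ.* + M)                             ≈⟨ periodic-multiple (suc k) _ ⟨
      W ((z ℤ.+ -[1+ k ] ℤ.* + M) ℤ.+ + (suc k ℕ.* M))       ≡⟨ cong (λ t → W ((z ℤ.+ -[1+ k ] ℤ.* + M) ℤ.+ t)) (ℤ.pos-* (suc k) M) ⟩
      W ((z ℤ.+ ℤ.- (+ suc k) ℤ.* + M) ℤ.+ + suc k ℤ.* + M)  ≡⟨ cong W (cancel z (+ suc k) (+ M)) ⟩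
      W z                                                    ∎
      where
      cancel : ∀ z a b → (z ℤ.+ ℤ.- a ℤ.* b) ℤ.+ a ℤ.* b ≡ z
      cancel = solve-ℤ

  periodic-gcd : ∀ {W a b} → Periodic W a → Periodic W b → Periodic W (gcd a b)
  periodic-gcd {W} {a} {b} W-a W-b z with Bézout.identity (gcd-GCD a b)
  ... | Bézout.+- x y g+yb≡xa = begin
    W (z ℤ.+ + gcd a b)                            ≈⟨ periodic-multiple W-b y _ ⟨
    W ((z ℤ.+ + gcd a b) ℤ.+ + (y ℕ.* b))          ≡⟨ cong W (ℤ.+-assoc z _ _) ⟩
    W (z ℤ.+ + (gcd a b ℕ.+ y ℕ.* b))              ≡⟨ cong (λ t → W (z ℤ.+ + t)) g+yb≡xa ⟩
    W (z ℤ.+ + (x ℕ.* a))                          ≈⟨ periodic-multiple W-a x z ⟩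
    W z                                            ∎
  ... | Bézout.-+ x y g+xa≡yb = begin
    W (z ℤ.+ + gcd a b)                            ≈⟨ periodic-multiple W-a x _ ⟨
    W ((z ℤ.+ + gcd a b) ℤ.+ + (x ℕ.* a))          ≡⟨ cong W (ℤ.+-assoc z _ _) ⟩
    W (z ℤ.+ + (gcd a b ℕ.+ x ℕ.* a))              ≡⟨ cong (λ t → W (z ℤ.+ + t)) g+xa≡yb ⟩
    W (z ℤ.+ + (y ℕ.* b))                          ≈⟨ periodic-multiple W-b y z ⟩
    W z                                            ∎

  periodic-odd-multiple : ∀ {W D N} → Periodic W (D ℕ.+ D) → D ∣ N → ¬ (D ℕ.+ D ∣ N) → W (+ N) ≈ W (+ D)
  periodic-odd-multiple {W} {D} (W-periodic) (divides k ≡.refl) 2D∤kD with halve k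
  ... | h , inj₁ ≡.refl = contradiction (divides h (double-multiple h D)) 2D∤kD
    where
    double-multiple : ∀ h D → (h ℕ.+ h) ℕ.* D ≡ h ℕ.* (D ℕ.+ D)
    double-multiple = solve-ℕ
  ... | h , inj₂ ≡.refl = begin
    W (+ (suc (h ℕ.+ h) ℕ.* D))       ≡⟨ cong (λ t → W (+ t)) (odd-multiple h D) ⟩
    W (+ D ℤ.+ + (h ℕ.* (D ℕ.+ D)))   ≈⟨ periodic-multiple W-periodic h (+ D) ⟩
    W (+ D)                           ∎
    where
    odd-multiple : ∀ h D → suc (h ℕ.+ h) ℕ.* D ≡ D ℕ.+ h ℕ.* (D ℕ.+ D)
    odd-multiple = solve-ℕ

  symmetric-at-multiple : ∀ {s W P c} → (∀ {x y} → x ≈ y → s x ≈ s y) →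
    Periodic W (P ℕ.+ P) → SymmetricAbout s 0ℤ W → P ∣ c → SymmetricAbout s (+ c) W
  symmetric-at-multiple {s} {W} {P} s-cong W-periodic W-symmetric (divides k ≡.refl) z = begin
    W (+ (k ℕ.* P) ℤ.- z)                               ≡⟨ cong W (recentre (+ (k ℕ.* P)) z) ⟩
    W (0ℤ ℤ.- (z ℤ.- + (k ℕ.* P)))                      ≈⟨ W-symmetric (z ℤ.- + (k ℕ.* P)) ⟩
    s (W (0ℤ ℤ.+ (z ℤ.- + (k ℕ.* P))))                  ≈⟨ s-cong (periodic-multiple W-periodic k _) ⟨
    s (W ((0ℤ ℤ.+ (z ℤ.- + (k ℕ.* P))) ℤ.+ + (k ℕ.* (P ℕ.+ P))))
                                                        ≡⟨ cong (λ t → s (W ((0ℤ ℤ.+ (z ℤ.- + (k ℕ.* P))) ℤ.+ + t))) (ℕ.*-distribˡ-+ k P P) ⟩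
    s (W ((0ℤ ℤ.+ (z ℤ.- + (k ℕ.* P))) ℤ.+ (+ (k ℕ.* P) ℤ.+ + (k ℕ.* P))))
                                                        ≡⟨ cong (s ∘ W) (unshift (+ (k ℕ.* P)) z) ⟩
    s (W (+ (k ℕ.* P) ℤ.+ z))                           ∎
    where
    recentre : ∀ c z → c ℤ.- z ≡ 0ℤ ℤ.- (z ℤ.- c)
    recentre = solve-ℤ
    unshift : ∀ c z → (0ℤ ℤ.+ (z ℤ.- c)) ℤ.+ (c ℤ.+ c) ≡ c ℤ.+ z
    unshift = solve-ℤ

  module Reflection (P : ℕ) .{{_ : NonZero P}} where

    instance
      period-nonZero : NonZero (P ℕ.+ P)
      period-nonZero = ℕ.>-nonZero (ℕ.<-≤-trans (ℕ.>-nonZero⁻¹ P) (ℕ.m≤m+n P P))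

    open Residue (P ℕ.+ P)

    private
      reflect-> : ∀ {r} → r < P → P < P ℕ.+ P ℕ.∸ r
      reflect-> {r} r<P = ≡.subst (_< P ℕ.+ P ℕ.∸ r) (ℕ.m+n∸m≡n P P) (ℕ.∸-monoʳ-< r<P (ℕ.m≤m+n P P))

      reflect-≤ : ∀ {r} → P < r → P ℕ.+ P ℕ.∸ r ≤ P
      reflect-≤ {r} P<r = ≡.subst (P ℕ.+ P ℕ.∸ r ≤_) (ℕ.m+n∸m≡n P P) (ℕ.∸-monoʳ-≤ (P ℕ.+ P) (ℕ.<⇒≤ P<r))

    -- s = -_ gives the odd and s = id the even 2P-periodic extension of h from [0, P].
    module Extension (s : Carrier → Carrier) (h : ℕ → Carrier) where

      unfold : ℕ → Carrier
      unfold r with P <? r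
      ... | yes _ = s (h (P ℕ.+ P ℕ.∸ r))
      ... | no  _ = h r

      extension : ℤ → Carrier
      extension z = unfold (residue z)

      unfold-≤ : ∀ {r} → r ≤ P → unfold r ≈ h r
      unfold-≤ {r} r≤P with P <? r
      ... | yes P<r = contradiction r≤P (ℕ.<⇒≱ P<r)
      ... | no  _   = refl

      unfold-> : ∀ {r} → P < r → unfold r ≈ s (h (P ℕ.+ P ℕ.∸ r))
      unfold-> {r} P<r with P <? r
      ... | yes _    = refl
      ... | no  P≮r  = contradiction P<r P≮r

      extension-periodic : Periodic extension (P ℕ.+ P)
      extension-periodic z = reflexive (cong unfold (residue-periodic z))

      extension-agrees : ∀ {a} → a ≤ P → extension (+ a) ≈ h a
      extension-agrees {a} a≤P = trans (reflexive (cong unfold (residue-small a<2P))) (unfold-≤ a≤P)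
        where a<2P = ℕ.≤-<-trans a≤P (ℕ.m<m+n P (ℕ.>-nonZero⁻¹ P))

      extension-values : ∀ z → ∃ λ a → extension z ≈ h a ⊎ extension z ≈ s (h a)
      extension-values z with residue z ℕ.≤? P
      ... | yes r≤P = residue z , inj₁ (unfold-≤ r≤P)
      ... | no  r≰P = P ℕ.+ P ℕ.∸ residue z , inj₂ (unfold-> (ℕ.≰⇒> r≰P))

      module _ (s-cong : ∀ {x y} → x ≈ y → s x ≈ s y) (s-involutive : ∀ x → s (s x) ≈ x)
               (h-0 : h 0 ≈ s (h 0)) (h-P : h P ≈ s (h P)) where

        unfold-reflect : ∀ {r} → r ≤ P ℕ.+ P → unfold (P ℕ.+ P ℕ.∸ r) ≈ s (unfold r)
        unfold-reflect {r} r≤2P with ℕ.<-cmp r P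
        ... | tri< r<P _ _ = begin
          unfold (P ℕ.+ P ℕ.∸ r)                   ≈⟨ unfold-> (reflect-> r<P) ⟩
          s (h (P ℕ.+ P ℕ.∸ (P ℕ.+ P ℕ.∸ r)))      ≡⟨ cong (s ∘ h) (ℕ.m∸[m∸n]≡n r≤2P) ⟩
          s (h r)                                  ≈⟨ s-cong (unfold-≤ (ℕ.<⇒≤ r<P)) ⟨
          s (unfold r)                             ∎
        ... | tri≈ _ ≡.refl _ = begin
          unfold (P ℕ.+ P ℕ.∸ P)   ≡⟨ cong unfold (ℕ.m+n∸m≡n P P) ⟩
          unfold P                 ≈⟨ unfold-≤ ℕ.≤-refl ⟩
          h P                      ≈⟨ h-P ⟩
          s (h P)                  ≈⟨ s-cong (unfold-≤ ℕ.≤-refl) ⟨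
          s (unfold P)             ∎
        ... | tri> _ _ P<r = begin
          unfold (P ℕ.+ P ℕ.∸ r)       ≈⟨ unfold-≤ (reflect-≤ P<r) ⟩
          h (P ℕ.+ P ℕ.∸ r)            ≈⟨ s-involutive _ ⟨
          s (s (h (P ℕ.+ P ℕ.∸ r)))    ≈⟨ s-cong (unfold-> P<r) ⟨
          s (unfold r)                 ∎

        extension-symmetric : SymmetricAbout s 0ℤ extension
        extension-symmetric z = begin
          extension (0ℤ ℤ.- z)        ≡⟨ cong extension (ℤ.+-identityˡ (ℤ.- z)) ⟩
          unfold (residue (ℤ.- z))    ≈⟨ negation (residue z) ≡.refl ⟩
          s (unfold (residue z))      ≡⟨ cong (s ∘ extension) (ℤ.+-identityˡ z) ⟨
          s (extension (0ℤ ℤ.+ z))    ∎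
          where
          negation : ∀ r → residue z ≡ r → unfold (residue (ℤ.- z)) ≈ s (unfold (residue z))
          negation zero r≡0 = begin
            unfold (residue (ℤ.- z))   ≡⟨ cong unfold (residue-neg-zero z r≡0) ⟩
            unfold 0                   ≈⟨ unfold-≤ z≤n ⟩
            h 0                        ≈⟨ h-0 ⟩
            s (h 0)                    ≈⟨ s-cong (unfold-≤ z≤n) ⟨
            s (unfold 0)               ≡⟨ cong (s ∘ unfold) r≡0 ⟨
            s (unfold (residue z))     ∎
          negation (suc _) r≡1+u = begin
            unfold (residue (ℤ.- z))              ≡⟨ cong unfold (residue-neg-suc z r≡1+u) ⟩
            unfold (P ℕ.+ P ℕ.∸ residue z)        ≈⟨ unfold-reflect (ℕ.<⇒≤ (n%ℕd<d z (P ℕ.+ P))) ⟩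
            s (unfold (residue z))                ∎

    module _ {s : Carrier → Carrier} {W : ℤ → Carrier}
             (W-periodic : Periodic W (P ℕ.+ P)) (W-symmetric : SymmetricAbout s 0ℤ W) where
      open Extension s (λ a → W (+ a))

      restriction-extends : ∀ z → W z ≈ extension z
      restriction-extends z = begin
        W z                                   ≡⟨ cong W (a≡a%ℕn+[a/ℕn]*n z (P ℕ.+ P)) ⟩
        W (+ residue z ℤ.+ (z /ℕ (P ℕ.+ P)) ℤ.* + (P ℕ.+ P))
                                              ≈⟨ periodic-ℤ-multiple W-periodic (z /ℕ (P ℕ.+ P)) (+ residue z) ⟩
        W (+ residue z)                       ≈⟨ from-residue (residue z ℕ.≤? P) ⟩
        unfold (residue z)                    ∎
        where
        r≤2P = ℕ.<⇒≤ (n%ℕd<d z (P ℕ.+ P))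
        reflect : ∀ r M → r ≡ (0ℤ ℤ.- (M ℤ.- r)) ℤ.+ M
        reflect = solve-ℤ
        from-residue : Dec (residue z ≤ P) → W (+ residue z) ≈ unfold (residue z)
        from-residue (yes r≤P) = sym (unfold-≤ r≤P)
        from-residue (no  r≰P) = begin
          W (+ r)                                       ≡⟨ cong W (reflect (+ r) (+ (P ℕ.+ P))) ⟩
          W ((0ℤ ℤ.- (+ (P ℕ.+ P) ℤ.- + r)) ℤ.+ + (P ℕ.+ P))
                                                        ≈⟨ W-periodic _ ⟩
          W (0ℤ ℤ.- (+ (P ℕ.+ P) ℤ.- + r))              ≡⟨ cong (λ t → W (0ℤ ℤ.- t)) 2P-r≡ ⟩
          W (0ℤ ℤ.- + (P ℕ.+ P ℕ.∸ r))                  ≈⟨ W-symmetric (+ (P ℕ.+ P ℕ.∸ r)) ⟩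
          s (W (0ℤ ℤ.+ + (P ℕ.+ P ℕ.∸ r)))              ≡⟨ cong (s ∘ W) (ℤ.+-identityˡ _) ⟩
          s (W (+ (P ℕ.+ P ℕ.∸ r)))                     ≈⟨ unfold-> (ℕ.≰⇒> r≰P) ⟨
          unfold r                                      ∎
          where
          r = residue z
          2P-r≡ = ≡.trans (ℤ.m-n≡m⊖n (P ℕ.+ P) r) (ℤ.⊖-≥ r≤2P)

    odd-periodic-vanishing : ∀ {W} → Periodic W (P ℕ.+ P) → SymmetricAbout -_ 0ℤ W →
                             (∀ a → a ≤ P → W (+ a) ≈ 0#) → ∀ z → W z ≈ 0#
    odd-periodic-vanishing {W} W-periodic W-odd W-small z =
      trans (restriction-extends W-periodic W-odd z) (unfolded (residue z ℕ.≤? P))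
      where
      open Extension -_ (λ a → W (+ a))
      unfolded : Dec (residue z ≤ P) → unfold (residue z) ≈ 0#
      unfolded (yes r≤P) = trans (unfold-≤ r≤P) (W-small _ r≤P)
      unfolded (no  r≰P) = begin
        unfold (residue z)                     ≈⟨ unfold-> (ℕ.≰⇒> r≰P) ⟩
        - W (+ (P ℕ.+ P ℕ.∸ residue z))        ≈⟨ -‿cong (W-small _ (reflect-≤ (ℕ.≰⇒> r≰P))) ⟩
        - 0#                                   ≈⟨ -0#≈0# ⟩
        0#                                     ∎

module Waves {c ℓ : Level} (R : CommutativeRing c ℓ) where
  open CommutativeRing R
  open import Algebra.Properties.Ring ring using (-0#≈0#; -‿involutive; -‿distribˡ-*; -‿distribʳ-*; x[y-z]≈xy-xz)
  open import Relation.Binary.Reasoning.Setoid setoid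
  open PeriodicFunctions R
  open IntegerCoefficients R using (solve; _:=_; _:+_; _:-_; :-_; con)

  alternating : ℕ → Carrier
  alternating zero    = 1#
  alternating (suc k) = - alternating k

  alternating-sign : ∀ k → alternating k ≈ 1# ⊎ alternating k ≈ - 1#
  alternating-sign zero    = inj₁ refl
  alternating-sign (suc k) with alternating-sign k
  ... | inj₁ α≈1  = inj₂ (-‿cong α≈1)
  ... | inj₂ α≈-1 = inj₁ (trans (-‿cong α≈-1) (-‿involutive 1#))

  alternating-square : ∀ k → alternating k * alternating k ≈ 1#
  alternating-square zero    = *-identityˡ 1#
  alternating-square (suc k) = begin
    - a * - a     ≈⟨ -‿distribˡ-* a (- a) ⟨
    - (a * - a)   ≈⟨ -‿cong (-‿distribʳ-* a a) ⟨
    - - (a * a)   ≈⟨ -‿involutive (a * a) ⟩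
    a * a         ≈⟨ alternating-square k ⟩
    1#            ∎
    where a = alternating k

  alternating-cancel : ∀ k {x} → alternating k * x ≈ 0# → x ≈ 0#
  alternating-cancel k {x} αx≈0 = begin
    x               ≈⟨ *-identityˡ x ⟨
    1# * x          ≈⟨ *-congʳ (alternating-square k) ⟨
    (α * α) * x     ≈⟨ *-assoc α α x ⟩
    α * (α * x)     ≈⟨ *-congˡ αx≈0 ⟩
    α * 0#          ≈⟨ zeroʳ α ⟩
    0#              ∎
    where α = alternating k

  module Wave (f : ℤ → Carrier) where

    -- Rows 0 and 1 are 0 and f; row Y + 2 is forced by the harmonic condition at row Y + 1.
    wave : ℕ → ℤ → Carrier
    wave zero          z = 0#
    wave (suc zero)    z = f z
    wave (suc (suc Y)) z = - (wave (suc Y) (z ℤ.- 1ℤ) + wave (suc Y) (z ℤ.+ 1ℤ)) - wave Y z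

    private
      swap : ∀ z a b → (z ℤ.+ a) ℤ.+ b ≡ (z ℤ.+ b) ℤ.+ a
      swap = solve-ℤ

    module _ {M} (f-periodic : Periodic f M) where

      wave-periodic : ∀ Y → Periodic (wave Y) M
      wave-periodic zero          z = refl
      wave-periodic (suc zero)    z = f-periodic z
      wave-periodic (suc (suc Y)) z =
        +-cong (-‿cong (+-cong (shifted (suc Y) (ℤ.- 1ℤ)) (shifted (suc Y) 1ℤ))) (-‿cong (wave-periodic Y z))
        where
        shifted : ∀ Y δ → wave Y ((z ℤ.+ + M) ℤ.+ δ) ≈ wave Y (z ℤ.+ δ)
        shifted Y δ = trans (reflexive (cong (wave Y) (swap z (+ M) δ))) (wave-periodic Y (z ℤ.+ δ))

    module _ {a} (f-odd : SymmetricAbout -_ a f) where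

      wave-antisymmetric : ∀ Y → SymmetricAbout -_ a (wave Y)
      wave-antisymmetric zero          z = sym -0#≈0#
      wave-antisymmetric (suc zero)    z = f-odd z
      wave-antisymmetric (suc (suc Y)) z = begin
        - (w₁ ((a ℤ.- z) ℤ.- 1ℤ) + w₁ ((a ℤ.- z) ℤ.+ 1ℤ)) - w₀ (a ℤ.- z)
          ≡⟨ cong₂ (λ s t → - (w₁ s + w₁ t) - w₀ (a ℤ.- z)) (inward a z) (outward a z) ⟩
        - (w₁ (a ℤ.- (z ℤ.+ 1ℤ)) + w₁ (a ℤ.- (z ℤ.- 1ℤ))) - w₀ (a ℤ.- z)
          ≈⟨ +-cong (-‿cong (+-cong (wave-antisymmetric (suc Y) _) (wave-antisymmetric (suc Y) _)))
                    (-‿cong (wave-antisymmetric Y z)) ⟩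
        - (- w₁ (a ℤ.+ (z ℤ.+ 1ℤ)) + - w₁ (a ℤ.+ (z ℤ.- 1ℤ))) - - w₀ (a ℤ.+ z)
          ≡⟨ cong₂ (λ s t → - (- w₁ s + - w₁ t) - - w₀ (a ℤ.+ z)) (ℤ.+-assoc a z 1ℤ) (ℤ.+-assoc a z _) ⟨
        - (- w₁ ((a ℤ.+ z) ℤ.+ 1ℤ) + - w₁ ((a ℤ.+ z) ℤ.- 1ℤ)) - - w₀ (a ℤ.+ z)
          ≈⟨ negate-step _ _ _ ⟩
        - (- (w₁ ((a ℤ.+ z) ℤ.- 1ℤ) + w₁ ((a ℤ.+ z) ℤ.+ 1ℤ)) - w₀ (a ℤ.+ z)) ∎
        where
        w₀ = wave Y
        w₁ = wave (suc Y)
        inward : ∀ a z → (a ℤ.- z) ℤ.- 1ℤ ≡ a ℤ.- (z ℤ.+ 1ℤ)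
        inward = solve-ℤ
        outward : ∀ a z → (a ℤ.- z) ℤ.+ 1ℤ ≡ a ℤ.- (z ℤ.- 1ℤ)
        outward = solve-ℤ
        negate-step : ∀ u v w → - (- v + - u) - - w ≈ - (- (u + v) - w)
        negate-step = solve 3 (λ u v w → :- (:- v :+ :- u) :- :- w := :- (:- (u :+ v) :- w)) refl

      wave-vanishes-at-centre : f a ≈ 0# → ∀ Y → wave Y a ≈ 0#
      wave-vanishes-at-centre f-a zero          = refl
      wave-vanishes-at-centre f-a (suc zero)    = f-a
      wave-vanishes-at-centre f-a (suc (suc Y)) = begin
        - (wave (suc Y) (a ℤ.- 1ℤ) + wave (suc Y) (a ℤ.+ 1ℤ)) - wave Y a
          ≈⟨ +-cong (-‿cong (+-congʳ (wave-antisymmetric (suc Y) 1ℤ))) (-‿cong (wave-vanishes-at-centre f-a Y)) ⟩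
        - (- wave (suc Y) (a ℤ.+ 1ℤ) + wave (suc Y) (a ℤ.+ 1ℤ)) - 0#
          ≈⟨ cancel _ ⟩
        0#  ∎
        where
        cancel : ∀ u → - (- u + u) - 0# ≈ 0#
        cancel = solve 1 (λ u → :- (:- u :+ u) :- con (+ 0) := con (+ 0)) refl

    wave-diagonalʳ : ∀ k z → wave k z + wave (suc k) (z ℤ.+ 1ℤ) ≈ alternating k * f (z ℤ.+ + suc k)
    wave-diagonalʳ zero    z = trans (+-identityˡ _) (sym (*-identityˡ _))
    wave-diagonalʳ (suc k) z = begin
      wave (suc k) z + (- (wave (suc k) ((z ℤ.+ 1ℤ) ℤ.- 1ℤ) + wave (suc k) ((z ℤ.+ 1ℤ) ℤ.+ 1ℤ)) - wave k (z ℤ.+ 1ℤ))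
        ≡⟨ cong (λ t → wave (suc k) z + (- (wave (suc k) t + wave (suc k) ((z ℤ.+ 1ℤ) ℤ.+ 1ℤ)) - wave k (z ℤ.+ 1ℤ))) (back z) ⟩
      wave (suc k) z + (- (wave (suc k) z + wave (suc k) ((z ℤ.+ 1ℤ) ℤ.+ 1ℤ)) - wave k (z ℤ.+ 1ℤ))
        ≈⟨ telescope _ _ _ ⟩
      - (wave k (z ℤ.+ 1ℤ) + wave (suc k) ((z ℤ.+ 1ℤ) ℤ.+ 1ℤ))
        ≈⟨ -‿cong (wave-diagonalʳ k (z ℤ.+ 1ℤ)) ⟩
      - (alternating k * f ((z ℤ.+ 1ℤ) ℤ.+ + suc k))
        ≈⟨ -‿distribˡ-* _ _ ⟩
      alternating (suc k) * f ((z ℤ.+ 1ℤ) ℤ.+ + suc k)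
        ≡⟨ cong (λ t → alternating (suc k) * f t) (step z (+ k)) ⟩
      alternating (suc k) * f (z ℤ.+ + suc (suc k)) ∎
      where
      back : ∀ z → (z ℤ.+ 1ℤ) ℤ.- 1ℤ ≡ z
      back = solve-ℤ
      step : ∀ z k → (z ℤ.+ 1ℤ) ℤ.+ (1ℤ ℤ.+ k) ≡ z ℤ.+ (1ℤ ℤ.+ (1ℤ ℤ.+ k))
      step = solve-ℤ
      telescope : ∀ u v w → u + (- (u + v) - w) ≈ - (w + v)
      telescope = solve 3 (λ u v w → u :+ (:- (u :+ v) :- w) := :- (w :+ v)) refl

    wave-diagonalˡ : ∀ k z → wave k z + wave (suc k) (z ℤ.- 1ℤ) ≈ alternating k * f (z ℤ.- + suc k)
    wave-diagonalˡ zero    z = trans (+-identityˡ _) (sym (*-identityˡ _))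
    wave-diagonalˡ (suc k) z = begin
      wave (suc k) z + (- (wave (suc k) ((z ℤ.- 1ℤ) ℤ.- 1ℤ) + wave (suc k) ((z ℤ.- 1ℤ) ℤ.+ 1ℤ)) - wave k (z ℤ.- 1ℤ))
        ≡⟨ cong (λ t → wave (suc k) z + (- (wave (suc k) ((z ℤ.- 1ℤ) ℤ.- 1ℤ) + wave (suc k) t) - wave k (z ℤ.- 1ℤ))) (back z) ⟩
      wave (suc k) z + (- (wave (suc k) ((z ℤ.- 1ℤ) ℤ.- 1ℤ) + wave (suc k) z) - wave k (z ℤ.- 1ℤ))
        ≈⟨ telescope _ _ _ ⟩
      - (wave k (z ℤ.- 1ℤ) + wave (suc k) ((z ℤ.- 1ℤ) ℤ.- 1ℤ))
        ≈⟨ -‿cong (wave-diagonalˡ k (z ℤ.- 1ℤ)) ⟩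
      - (alternating k * f ((z ℤ.- 1ℤ) ℤ.- + suc k))
        ≈⟨ -‿distribˡ-* _ _ ⟩
      alternating (suc k) * f ((z ℤ.- 1ℤ) ℤ.- + suc k)
        ≡⟨ cong (λ t → alternating (suc k) * f t) (step z (+ k)) ⟩
      alternating (suc k) * f (z ℤ.- + suc (suc k)) ∎
      where
      back : ∀ z → (z ℤ.- 1ℤ) ℤ.+ 1ℤ ≡ z
      back = solve-ℤ
      step : ∀ z k → (z ℤ.- 1ℤ) ℤ.- (1ℤ ℤ.+ k) ≡ z ℤ.- (1ℤ ℤ.+ (1ℤ ℤ.+ k))
      step = solve-ℤ
      telescope : ∀ u v w → u + (- (v + u) - w) ≈ - (w + v)
      telescope = solve 3 (λ u v w → u :+ (:- (v :+ u) :- w) := :- (w :+ v)) refl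

    wave-difference : ∀ k z → wave (suc k) (z ℤ.+ 1ℤ) - wave (suc k) (z ℤ.- 1ℤ)
                              ≈ alternating k * (f (z ℤ.+ + suc k) - f (z ℤ.- + suc k))
    wave-difference k z = begin
      wave (suc k) (z ℤ.+ 1ℤ) - wave (suc k) (z ℤ.- 1ℤ)
        ≈⟨ cancel (wave k z) _ _ ⟩
      (wave k z + wave (suc k) (z ℤ.+ 1ℤ)) - (wave k z + wave (suc k) (z ℤ.- 1ℤ))
        ≈⟨ +-cong (wave-diagonalʳ k z) (-‿cong (wave-diagonalˡ k z)) ⟩
      alternating k * f (z ℤ.+ + suc k) - alternating k * f (z ℤ.- + suc k)
        ≈⟨ x[y-z]≈xy-xz _ _ _ ⟨
      alternating k * (f (z ℤ.+ + suc k) - f (z ℤ.- + suc k)) ∎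
      where
      cancel : ∀ u v w → v - w ≈ (u + v) - (u + w)
      cancel = solve 3 (λ u v w → v :- w := (u :+ v) :- (u :+ w)) refl

    wave-zero : (∀ z → f z ≈ 0#) → ∀ Y z → wave Y z ≈ 0#
    wave-zero f≈0 zero          z = refl
    wave-zero f≈0 (suc zero)    z = f≈0 z
    wave-zero f≈0 (suc (suc Y)) z = begin
      - (wave (suc Y) (z ℤ.- 1ℤ) + wave (suc Y) (z ℤ.+ 1ℤ)) - wave Y z
        ≈⟨ +-cong (-‿cong (+-cong (wave-zero f≈0 (suc Y) _) (wave-zero f≈0 (suc Y) _))) (-‿cong (wave-zero f≈0 Y z)) ⟩
      - (0# + 0#) - 0#
        ≈⟨ solve 0 (:- (con (+ 0) :+ con (+ 0)) :- con (+ 0) := con (+ 0)) refl ⟩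
      0# ∎

module HarmonicFunctions {c ℓ : Level} (R : CommutativeRing c ℓ) where
  open CommutativeRing R
  open import Data.Product using (_×_)
  open import Algebra.Properties.Ring ring using (-0#≈0#; -‿involutive)
  open import Algebra.Properties.AbelianGroup +-abelianGroup using (x∙y⁻¹≈ε⇒x≈y)
  open import Relation.Binary.Reasoning.Setoid setoid
  open PeriodicFunctions R
  open Waves R
  open IntegerCoefficients R using (solve; _:=_; _:+_; _:-_; :-_)

  -- Grid point (x , y) sits at (x + 1 , y + 1) of the frame, so this sums over the neighbours of (x , y).
  neighbourSum : (ℕ → ℕ → Carrier) → ℕ → ℕ → Carrier
  neighbourSum φ x y = ((φ x (suc y) + φ (suc (suc x)) (suc y)) + φ (suc x) y) + φ (suc x) (suc (suc y))

  IsHarmonic : ℕ → ℕ → (ℕ → ℕ → Carrier) → Set ℓ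
  IsHarmonic m n φ = ∀ x y → x < m → y < n → neighbourSum φ x y ≈ 0#

  record VanishesOnFrame (p q : ℕ) (φ : ℕ → ℕ → Carrier) : Set ℓ where
    field
      left   : ∀ Y → φ 0 Y ≈ 0#
      bottom : ∀ X → φ X 0 ≈ 0#
      right  : ∀ Y → φ p Y ≈ 0#
      top    : ∀ X → φ X q ≈ 0#

  upper-neighbour : ∀ φ x y → neighbourSum φ x y ≈ 0# →
    φ (suc x) (suc (suc y)) ≈ - (φ x (suc y) + φ (suc (suc x)) (suc y)) - φ (suc x) y
  upper-neighbour φ x y sum≈0 = begin
    φ (suc x) (suc (suc y))                    ≈⟨ isolate _ _ _ _ ⟩
    - (u + v) - w + neighbourSum φ x y         ≈⟨ +-congˡ sum≈0 ⟩
    - (u + v) - w + 0#                         ≈⟨ +-identityʳ _ ⟩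
    - (u + v) - w                              ∎
    where
    u = φ x (suc y)
    v = φ (suc (suc x)) (suc y)
    w = φ (suc x) y
    isolate : ∀ a b c d → d ≈ - (a + b) - c + (((a + b) + c) + d)
    isolate = solve 4 (λ a b c d → d := :- (a :+ b) :- c :+ (((a :+ b) :+ c) :+ d)) refl

  Supported : ℕ → (ℕ → ℕ → Carrier) → Set ℓ
  Supported e φ = ∀ X Y → even (X ℕ.+ Y ℕ.+ e) ≡ false → φ X Y ≈ 0#

  supported-neighbourSum : ∀ {e φ} → Supported e φ → ∀ x y → even (x ℕ.+ y ℕ.+ e) ≡ true → neighbourSum φ x y ≈ 0#
  supported-neighbourSum {e} {φ} φ-supported x y x+y-even = begin
    ((φ x (suc y) + φ (suc (suc x)) (suc y)) + φ (suc x) y) + φ (suc x) (suc (suc y))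
      ≈⟨ +-cong (+-cong (+-cong (φ-supported _ _ (≡.trans (cong (λ t → even (t ℕ.+ e)) (ℕ.+-suc x y)) odd))
                                (φ-supported _ _ (≡.trans (cong (λ t → even (t ℕ.+ e)) (ℕ.+-suc x y)) odd)))
                        (φ-supported _ _ odd))
                (φ-supported _ _ (≡.trans (cong (λ t → even (suc t ℕ.+ e)) (≡.trans (ℕ.+-suc x (suc y)) (cong suc (ℕ.+-suc x y)))) odd)) ⟩
    ((0# + 0#) + 0#) + 0#
      ≈⟨ trans (+-identityʳ _) (trans (+-identityʳ _) (+-identityʳ _)) ⟩
    0# ∎
    where
    odd : even (suc (x ℕ.+ y ℕ.+ e)) ≡ false
    odd = ≡.trans (even-suc (x ℕ.+ y ℕ.+ e)) (cong not x+y-even)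

  module Uniqueness {m n φ} (φ-frame : VanishesOnFrame (suc m) (suc n) φ) (φ-harmonic : IsHarmonic m n φ) where
    open VanishesOnFrame φ-frame
    open Reflection (suc m) using (module Extension; odd-periodic-vanishing)
    open Extension -_ (λ X → φ X 1) using (extension; extension-periodic; extension-agrees; extension-symmetric)

    private
      p q : ℕ
      p = suc m
      q = suc n

      ≈0⇒≈- : ∀ {x} → x ≈ 0# → x ≈ - x
      ≈0⇒≈- x≈0 = trans x≈0 (sym (trans (-‿cong x≈0) -0#≈0#))

    row : ℤ → Carrier
    row = extension

    row-periodic : Periodic row (p ℕ.+ p)
    row-periodic = extension-periodic

    row-odd : SymmetricAbout -_ 0ℤ row
    row-odd = extension-symmetric -‿cong -‿involutive (≈0⇒≈- (left 1)) (≈0⇒≈- (right 1))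

    row-antisymmetric-at-p : SymmetricAbout -_ (+ p) row
    row-antisymmetric-at-p = symmetric-at-multiple -‿cong row-periodic row-odd ∣-refl

    row-agrees : ∀ {X} → X ≤ p → row (+ X) ≈ φ X 1
    row-agrees = extension-agrees

    open Wave row

    wave-agrees : ∀ Y → Y ≤ q → ∀ X → X ≤ p → wave Y (+ X) ≈ φ X Y
    wave-agrees zero    _    X _ = sym (bottom X)
    wave-agrees (suc Y) 1+Y≤q = proj₂ (consecutive Y 1+Y≤q)
      where
      consecutive : ∀ Y → suc Y ≤ q → (∀ X → X ≤ p → wave Y (+ X) ≈ φ X Y)
                                     × (∀ X → X ≤ p → wave (suc Y) (+ X) ≈ φ X (suc Y))
      consecutive zero    _ = (λ X _ → sym (bottom X)) , (λ X → row-agrees)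
      consecutive (suc Y) (s≤s 1+Y≤n) = proj₂ below , next
        where
        below = consecutive Y (ℕ.m≤n⇒m≤1+n 1+Y≤n)
        next : ∀ X → X ≤ p → wave (suc (suc Y)) (+ X) ≈ φ X (suc (suc Y))
        next zero _ = trans (wave-vanishes-at-centre row-odd (trans (row-agrees z≤n) (left 1)) (suc (suc Y)))
                            (sym (left _))
        next (suc x) (s≤s x≤m) with x <? m
        ... | no x≮m rewrite ℕ.≤-antisym x≤m (ℕ.≮⇒≥ x≮m) =
          trans (wave-vanishes-at-centre row-antisymmetric-at-p (trans (row-agrees ℕ.≤-refl) (right 1)) (suc (suc Y)))
                (sym (right _))
        ... | yes x<m = begin
          - (wave (suc Y) (+ suc x ℤ.- 1ℤ) + wave (suc Y) (+ suc x ℤ.+ 1ℤ)) - wave Y (+ suc x)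
            ≡⟨ cong₂ (λ s t → - (wave (suc Y) s + wave (suc Y) t) - wave Y (+ suc x)) (left-of x) (right-of x) ⟩
          - (wave (suc Y) (+ x) + wave (suc Y) (+ suc (suc x))) - wave Y (+ suc x)
            ≈⟨ +-cong (-‿cong (+-cong (proj₂ below x (ℕ.m≤n⇒m≤1+n x≤m)) (proj₂ below (suc (suc x)) (s≤s x<m))))
                      (-‿cong (proj₁ below (suc x) (s≤s x≤m))) ⟩
          - (φ x (suc Y) + φ (suc (suc x)) (suc Y)) - φ (suc x) Y
            ≈⟨ upper-neighbour φ x Y (φ-harmonic x Y x<m 1+Y≤n) ⟨
          φ (suc x) (suc (suc Y)) ∎
          where
          left-of : ∀ x → + suc x ℤ.- 1ℤ ≡ + x
          left-of x = simplify (+ x)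
            where simplify : ∀ x → (1ℤ ℤ.+ x) ℤ.- 1ℤ ≡ x
                  simplify = solve-ℤ
          right-of : ∀ x → + suc x ℤ.+ 1ℤ ≡ + suc (suc x)
          right-of x = cong +_ (ℕ.+-comm (suc x) 1)

    top-wave-vanishes : ∀ z → wave q z ≈ 0#
    top-wave-vanishes = odd-periodic-vanishing (wave-periodic row-periodic q) (wave-antisymmetric {a = 0ℤ} row-odd q)
                          (λ X X≤p → trans (wave-agrees q ℕ.≤-refl X X≤p) (top X))

    row-periodic-q : Periodic row (q ℕ.+ q)
    row-periodic-q z = begin
      row (z ℤ.+ + (q ℕ.+ q))         ≡⟨ cong row (ℤ.+-assoc z (+ q) (+ q)) ⟨
      row ((z ℤ.+ + q) ℤ.+ + q)       ≈⟨ x∙y⁻¹≈ε⇒x≈y _ _ (alternating-cancel n (begin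
          alternating n * (row ((z ℤ.+ + q) ℤ.+ + q) - row ((z ℤ.+ + q) ℤ.- + q))
            ≈⟨ wave-difference n (z ℤ.+ + q) ⟨
          wave q ((z ℤ.+ + q) ℤ.+ 1ℤ) - wave q ((z ℤ.+ + q) ℤ.- 1ℤ)
            ≈⟨ +-cong (top-wave-vanishes _) (-‿cong (top-wave-vanishes _)) ⟩
          0# - 0#
            ≈⟨ -‿inverseʳ 0# ⟩
          0# ∎)) ⟩
      row ((z ℤ.+ + q) ℤ.- + q)       ≡⟨ cong row (unshift z (+ q)) ⟩
      row z                           ∎
      where
      unshift : ∀ z q → (z ℤ.+ q) ℤ.- q ≡ z
      unshift = solve-ℤ

    row-at-q : row (+ q) ≈ 0#
    row-at-q = alternating-cancel n (begin
      alternating n * row (+ q)                ≈⟨ wave-diagonalʳ n 0ℤ ⟨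
      wave n 0ℤ + wave q 1ℤ                    ≈⟨ +-cong (wave-vanishes-at-centre {a = 0ℤ} row-odd row-0 n) (top-wave-vanishes 1ℤ) ⟩
      0# + 0#                                  ≈⟨ +-identityʳ 0# ⟩
      0#                                       ∎)
      where row-0 = trans (row-agrees z≤n) (left 1)

    private
      d : ℕ
      d = gcd p q

      instance
        d-nonZero : NonZero d
        d-nonZero = ℕ.≢-nonZero (gcd[m,n]≢0 p q (inj₁ λ ()))

    row-periodic-gcd : Periodic row (d ℕ.+ d)
    row-periodic-gcd = ≡.subst (Periodic row) gcd-double (periodic-gcd row-periodic row-periodic-q)
      where
      double : ∀ x → 2 ℕ.* x ≡ x ℕ.+ x
      double = solve-ℕ
      gcd-double : gcd (p ℕ.+ p) (q ℕ.+ q) ≡ d ℕ.+ d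
      gcd-double = ≡.trans (≡.sym (cong₂ gcd (double p) (double q)))
                           (≡.trans (≡.sym (c*gcd[m,n]≡gcd[cm,cn] 2 p q)) (double d))

    -- row vanishes at p and at q, and one of them is an odd multiple of d.
    row-at-gcd : row (+ d) ≈ 0#
    row-at-gcd with (d ℕ.+ d) ∣? p | (d ℕ.+ d) ∣? q
    ... | no 2d∤p | _       = trans (sym (periodic-odd-multiple row-periodic-gcd (gcd[m,n]∣m p q) 2d∤p))
                                    (trans (row-agrees ℕ.≤-refl) (right 1))
    ... | yes _   | no 2d∤q = trans (sym (periodic-odd-multiple row-periodic-gcd (gcd[m,n]∣n p q) 2d∤q)) row-at-q
    ... | yes 2d∣p | yes 2d∣q =
      contradiction (∣⇒≤ (gcd-greatest 2d∣p 2d∣q)) (ℕ.<⇒≱ (ℕ.m<m+n d (ℕ.>-nonZero⁻¹ d)))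

    vanishes : (∀ x → suc x < gcd p q → φ (suc x) 1 ≈ 0#) → ∀ X Y → X ≤ p → Y ≤ q → φ X Y ≈ 0#
    vanishes φ-row X Y X≤p Y≤q = begin
      φ X Y          ≈⟨ wave-agrees Y Y≤q X X≤p ⟨
      wave Y (+ X)   ≈⟨ wave-zero row-vanishes Y (+ X) ⟩
      0#             ∎
      where
      row-small : ∀ a → a ≤ d → row (+ a) ≈ 0#
      row-small zero    _ = trans (row-agrees z≤n) (left 1)
      row-small (suc x) 1+x≤d with suc x <? d
      ... | yes 1+x<d = trans (row-agrees (ℕ.≤-trans (ℕ.<⇒≤ 1+x<d) (∣⇒≤ (gcd[m,n]∣m p q)))) (φ-row x 1+x<d)
      ... | no 1+x≮d rewrite ℕ.≤-antisym 1+x≤d (ℕ.≮⇒≥ 1+x≮d) = row-at-gcd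
      row-vanishes = Reflection.odd-periodic-vanishing d row-periodic-gcd row-odd row-small

  harmonic-vanishing : ∀ {m n φ} → VanishesOnFrame (suc m) (suc n) φ → IsHarmonic m n φ →
    (∀ x → suc x < gcd (suc m) (suc n) → φ (suc x) 1 ≈ 0#) →
    ∀ X Y → X ≤ suc m → Y ≤ suc n → φ X Y ≈ 0#
  harmonic-vanishing φ-frame φ-harmonic = Uniqueness.vanishes φ-frame φ-harmonic

module StandingWaves {c ℓ : Level} (R : CommutativeRing c ℓ) where
  open CommutativeRing R
  open import Algebra.Properties.Ring ring using (-0#≈0#; -‿involutive; -1*x≈-x)
  open import Relation.Binary.Reasoning.Setoid setoid
  open PeriodicFunctions R
  open Waves R using (alternating; alternating-sign)
  open HarmonicFunctions R
  open IntegerCoefficients R using (solve; _:=_; _:+_; _:-_; _:*_; :-_; con)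

  IsSign : Carrier → Set ℓ
  IsSign x = x ≈ 0# ⊎ x ≈ 1# ⊎ x ≈ - 1#

  if-zero : ∀ π {x} → x ≈ 0# → (if π then x else 0#) ≈ 0#
  if-zero true  x≈0 = x≈0
  if-zero false _   = refl

  if-cong : ∀ π {x y} → x ≈ y → (if π then x else 0#) ≈ (if π then y else 0#)
  if-cong true  x≈y = x≈y
  if-cong false _   = refl

  private
    scaled-difference-zero : ∀ t {a b} → a ≈ b → t * (a - b) ≈ 0#
    scaled-difference-zero t {a} a≈b = trans (*-congˡ (trans (+-congˡ (-‿cong (sym a≈b))) (-‿inverseʳ a))) (zeroʳ t)

    Bit : Carrier → Set ℓ
    Bit x = x ≈ 0# ⊎ x ≈ 1#

    difference-sign : ∀ {a b} → Bit a → Bit b → IsSign (a - b)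
    difference-sign (inj₁ a≈0) (inj₁ b≈0) = inj₁ (trans (+-cong a≈0 (-‿cong b≈0)) (-‿inverseʳ 0#))
    difference-sign (inj₂ a≈1) (inj₂ b≈1) = inj₁ (trans (+-cong a≈1 (-‿cong b≈1)) (-‿inverseʳ 1#))
    difference-sign (inj₂ a≈1) (inj₁ b≈0) =
      inj₂ (inj₁ (trans (+-cong a≈1 (trans (-‿cong b≈0) -0#≈0#)) (+-identityʳ 1#)))
    difference-sign (inj₁ a≈0) (inj₂ b≈1) = inj₂ (inj₂ (trans (+-cong a≈0 (-‿cong b≈1)) (+-identityˡ (- 1#))))

    IsSign-resp : ∀ {x y} → x ≈ y → IsSign y → IsSign x
    IsSign-resp x≈y = ⊎.map (trans x≈y) (⊎.map (trans x≈y) (trans x≈y))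

    negate-sign : ∀ {x} → IsSign x → IsSign (- x)
    negate-sign (inj₁ x≈0)        = inj₁ (trans (-‿cong x≈0) -0#≈0#)
    negate-sign (inj₂ (inj₁ x≈1))  = inj₂ (inj₂ (-‿cong x≈1))
    negate-sign (inj₂ (inj₂ x≈-1)) = inj₂ (inj₁ (trans (-‿cong x≈-1) (-‿involutive 1#)))

    scale-sign : ∀ {t x} → t ≈ 1# ⊎ t ≈ - 1# → IsSign x → IsSign (t * x)
    scale-sign (inj₁ t≈1)  x-sign = IsSign-resp (trans (*-congʳ t≈1) (*-identityˡ _)) x-sign
    scale-sign (inj₂ t≈-1) x-sign = IsSign-resp (trans (*-congʳ t≈-1) (-1*x≈-x _)) (negate-sign x-sign)

  module Standing (e : ℕ) (g : ℤ → Carrier) where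

    -- The alternating sign and the restriction to one colour class make d'Alembert's solution
    -- g (X + Y) − g (X − Y) of the discrete wave equation harmonic, whatever g is.
    standing : ℕ → ℕ → Carrier
    standing X Y = if even (X ℕ.+ Y ℕ.+ e) then alternating (suc Y) * (g (+ (X ℕ.+ Y)) - g (+ X ℤ.- + Y)) else 0#

    standing-harmonic : ∀ x y → neighbourSum standing x y ≈ 0#
    standing-harmonic x y rewrite ℕ.+-suc x (suc y) | ℕ.+-suc x y =
      cancellation (even (suc (x ℕ.+ y ℕ.+ e))) (alternating (suc y)) (g (+ suc (x ℕ.+ y)))
        (g (+ suc (suc (suc (x ℕ.+ y))))) (g (+ x ℤ.- + suc y)) (g (+ suc x ℤ.- + y))
        (cong g (lower-shift (+ x) (+ y))) (cong g (upper-shift (+ x) (+ y)))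
      where
      lower-shift : ∀ x y → (1ℤ ℤ.+ x) ℤ.- (1ℤ ℤ.+ (1ℤ ℤ.+ y)) ≡ x ℤ.- (1ℤ ℤ.+ y)
      lower-shift = solve-ℤ
      upper-shift : ∀ x y → (1ℤ ℤ.+ (1ℤ ℤ.+ x)) ℤ.- (1ℤ ℤ.+ y) ≡ (1ℤ ℤ.+ x) ℤ.- y
      upper-shift = solve-ℤ
      cancellation : ∀ π t a₁ a₂ b₁ b₂ {b₁′ b₂′} → b₁′ ≡ b₁ → b₂′ ≡ b₂ →
        (((if π then - t * (a₁ - b₁) else 0#) + (if π then - t * (a₂ - b₂′) else 0#))
          + (if π then t * (a₁ - b₂) else 0#)) + (if π then - - t * (a₂ - b₁′) else 0#) ≈ 0#
      cancellation false _ _ _ _ _ _ _ = trans (+-identityʳ _) (trans (+-identityʳ _) (+-identityʳ _))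
      cancellation true  t a₁ a₂ b₁ b₂ ≡.refl ≡.refl = solve 5 (λ t a₁ a₂ b₁ b₂ →
        (((:- t :* (a₁ :- b₁)) :+ (:- t :* (a₂ :- b₂))) :+ (t :* (a₁ :- b₂))) :+ (:- :- t :* (a₂ :- b₁))
          := con (+ 0)) refl t a₁ a₂ b₁ b₂

    standing-left : SymmetricAbout id 0ℤ g → ∀ Y → standing 0 Y ≈ 0#
    standing-left g-even Y = if-zero (even (Y ℕ.+ e)) (scaled-difference-zero _ (sym (g-even (+ Y))))

    standing-bottom : ∀ X → standing X 0 ≈ 0#
    standing-bottom X = if-zero (even (X ℕ.+ 0 ℕ.+ e)) (scaled-difference-zero _ refl)

    standing-right : ∀ {P} → SymmetricAbout id (+ P) g → ∀ Y → standing P Y ≈ 0#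
    standing-right {P} g-even Y = if-zero (even (P ℕ.+ Y ℕ.+ e)) (scaled-difference-zero _ (sym (g-even (+ Y))))

    standing-top : ∀ {Q} → Periodic g (Q ℕ.+ Q) → ∀ X → standing X Q ≈ 0#
    standing-top {Q} g-periodic X = if-zero (even (X ℕ.+ Q ℕ.+ e)) (scaled-difference-zero _ (begin
      g (+ X ℤ.+ + Q)                            ≡⟨ cong g (unshift (+ X) (+ Q)) ⟨
      g ((+ X ℤ.- + Q) ℤ.+ (+ Q ℤ.+ + Q))        ≈⟨ g-periodic _ ⟩
      g (+ X ℤ.- + Q)                            ∎))
      where
      unshift : ∀ x q → (x ℤ.- q) ℤ.+ (q ℤ.+ q) ≡ x ℤ.+ q
      unshift = solve-ℤ

    standing-supported : Supported e standing
    standing-supported X Y odd rewrite odd = refl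

    standing-values : (∀ z → g z ≈ 0# ⊎ g z ≈ 1#) → ∀ X Y → IsSign (standing X Y)
    standing-values g-bit X Y with even (X ℕ.+ Y ℕ.+ e)
    ... | true  = scale-sign (alternating-sign (suc Y)) (difference-sign (g-bit _) (g-bit _))
    ... | false = inj₁ refl

    standing-row : ∀ x → standing (suc x) 1 ≈ (if even (x ℕ.+ e) then g (+ suc (suc x)) - g (+ x) else 0#)
    standing-row x rewrite ℕ.+-comm x 1 = if-cong (even (x ℕ.+ e)) (begin
      - - 1# * (g (+ suc (suc x)) - g (+ suc x ℤ.- 1ℤ))   ≈⟨ *-congʳ (-‿involutive 1#) ⟩
      1# * (g (+ suc (suc x)) - g (+ suc x ℤ.- 1ℤ))       ≈⟨ *-identityˡ _ ⟩
      g (+ suc (suc x)) - g (+ suc x ℤ.- 1ℤ)              ≡⟨ cong (λ t → g (+ suc (suc x)) - g t) (unshift (+ x)) ⟩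
      g (+ suc (suc x)) - g (+ x)                         ∎)
      where
      unshift : ∀ x → (1ℤ ℤ.+ x) ℤ.- 1ℤ ≡ x
      unshift = solve-ℤ

  module BandWave (e d : ℕ) .{{_ : NonZero d}} (j : ℕ) (j-parity : even (j ℕ.+ e) ≡ true) where

    profile : ℕ → Carrier
    profile a with suc (suc j) ≤? a
    ... | yes _ = 1#
    ... | no  _ = 0#

    profile-≥ : ∀ {a} → suc (suc j) ≤ a → profile a ≈ 1#
    profile-≥ {a} j+2≤a with suc (suc j) ≤? a
    ... | yes _    = refl
    ... | no j+2≰a = contradiction j+2≤a j+2≰a

    profile-< : ∀ {a} → a < suc (suc j) → profile a ≈ 0#
    profile-< {a} a<j+2 with suc (suc j) ≤? a
    ... | yes j+2≤a = contradiction j+2≤a (ℕ.<⇒≱ a<j+2)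
    ... | no  _     = refl

    profile-bit : ∀ a → profile a ≈ 0# ⊎ profile a ≈ 1#
    profile-bit a with suc (suc j) ≤? a
    ... | yes _ = inj₂ refl
    ... | no  _ = inj₁ refl

    open Reflection d using (module Extension)
    open Extension id profile using (extension; extension-periodic; extension-symmetric; extension-agrees; extension-values)

    -- The even 2d-periodic indicator of distance ≥ j + 2 from 2dℤ.
    band : ℤ → Carrier
    band = extension

    open Standing e band

    bandWave : ℕ → ℕ → Carrier
    bandWave = standing

    bandWave-harmonic : ∀ x y → neighbourSum bandWave x y ≈ 0#
    bandWave-harmonic = standing-harmonic

    bandWave-frame : ∀ {p q} → d ∣ p → d ∣ q → VanishesOnFrame p q bandWave
    bandWave-frame d∣p (divides k ≡.refl) = record
      { left   = standing-left band-even
      ; bottom = standing-bottom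
      ; right  = standing-right (symmetric-at-multiple id extension-periodic band-even d∣p)
      ; top    = standing-top (periodic-∣ extension-periodic (divides k (≡.sym (ℕ.*-distribˡ-+ k d d))))
      }
      where band-even = extension-symmetric id (λ _ → refl) refl refl

    bandWave-supported : Supported e bandWave
    bandWave-supported = standing-supported

    bandWave-values : ∀ X Y → IsSign (bandWave X Y)
    bandWave-values = standing-values band-bit
      where
      band-bit : ∀ z → band z ≈ 0# ⊎ band z ≈ 1#
      band-bit z with extension-values z
      ... | a , inj₁ band≈h = ⊎.map (trans band≈h) (trans band≈h) (profile-bit a)
      ... | a , inj₂ band≈h = ⊎.map (trans band≈h) (trans band≈h) (profile-bit a)

    private
      row-profile : ∀ {x} → suc x < d →
        bandWave (suc x) 1 ≈ (if even (x ℕ.+ e) then profile (suc (suc x)) - profile x else 0#)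
      row-profile {x} 1+x<d = trans (standing-row x)
        (if-cong (even (x ℕ.+ e)) (+-cong (extension-agrees 1+x<d) (-‿cong (extension-agrees (ℕ.≤-trans (ℕ.n≤1+n x) (ℕ.<⇒≤ 1+x<d))))))

    bandWave-row-diagonal : suc j < d → bandWave (suc j) 1 ≈ 1#
    bandWave-row-diagonal 1+j<d = begin
      bandWave (suc j) 1                                                   ≈⟨ row-profile 1+j<d ⟩
      (if even (j ℕ.+ e) then profile (suc (suc j)) - profile j else 0#)  ≡⟨ cong (λ π → if π then profile (suc (suc j)) - profile j else 0#) j-parity ⟩
      profile (suc (suc j)) - profile j                                    ≈⟨ +-cong (profile-≥ ℕ.≤-refl) (-‿cong (profile-< (ℕ.m<n+m j (s≤s z≤n)))) ⟩
      1# - 0#                                                              ≈⟨ +-congˡ -0#≈0# ⟩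
      1# + 0#                                                              ≈⟨ +-identityʳ 1# ⟩
      1#                                                                   ∎

    bandWave-row-off : ∀ {x} → suc x < d → x ≢ j → bandWave (suc x) 1 ≈ 0#
    bandWave-row-off {x} 1+x<d x≢j = trans (row-profile 1+x<d) (step (even (x ℕ.+ e)) ≡.refl)
      where
      same-difference : ∀ {a b u} → a ≈ u → b ≈ u → a - b ≈ 0#
      same-difference {u = u} a≈u b≈u = trans (+-cong a≈u (-‿cong b≈u)) (-‿inverseʳ u)
      step : ∀ π → even (x ℕ.+ e) ≡ π → (if π then profile (suc (suc x)) - profile x else 0#) ≈ 0#
      step false _ = refl
      step true x-parity with ℕ.<-cmp x j
      ... | tri< x<j _ _ = same-difference (profile-< (s≤s (s≤s x<j))) (profile-< (ℕ.<-trans x<j (ℕ.m<n+m j (s≤s z≤n))))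
      ... | tri≈ _ x≡j _ = contradiction x≡j x≢j
      ... | tri> _ _ j<x with ℕ.m≤n⇒m<n∨m≡n j<x
      ...   | inj₁ 1+j<x   = same-difference (profile-≥ (ℕ.≤-trans (s≤s (ℕ.n≤1+n (suc j))) (s≤s (s≤s (ℕ.<⇒≤ 1+j<x))))) (profile-≥ 1+j<x)
      ...   | inj₂ ≡.refl  = contradiction (≡.trans (≡.sym x-parity) (≡.trans (even-suc (j ℕ.+ e)) (cong not j-parity))) λ ()

module GridSums {c ℓ : Level} (K : Field c ℓ) where
  open Field K
  open Linear K
  open import Relation.Binary.Reasoning.Setoid setoid
  open HarmonicFunctions commutativeRing using (neighbourSum; VanishesOnFrame)
  open StandingWaves commutativeRing using (if-cong)
  open IntegerCoefficients commutativeRing using (solve; _:=_; _:+_; _:-_; _:*_)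

  sumFin-cong : ∀ k {f g : Fin k → Carrier} → (∀ i → f i ≈ g i) → sumFin k f ≈ sumFin k g
  sumFin-cong zero    f≈g = refl
  sumFin-cong (suc k) f≈g = +-cong (f≈g Fin.zero) (sumFin-cong k (λ i → f≈g (Fin.suc i)))

  sumFin-zero : ∀ k {f : Fin k → Carrier} → (∀ i → f i ≈ 0#) → sumFin k f ≈ 0#
  sumFin-zero zero    f≈0 = refl
  sumFin-zero (suc k) f≈0 = trans (+-cong (f≈0 Fin.zero) (sumFin-zero k (λ i → f≈0 (Fin.suc i)))) (+-identityʳ 0#)

  sumFin-+ : ∀ k (f g : Fin k → Carrier) → sumFin k (λ i → f i + g i) ≈ sumFin k f + sumFin k g
  sumFin-+ zero    f g = sym (+-identityʳ 0#)
  sumFin-+ (suc k) f g = trans (+-congˡ (sumFin-+ k (λ i → f (Fin.suc i)) (λ i → g (Fin.suc i))))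
    (solve 4 (λ a b c d → (a :+ b) :+ (c :+ d) := (a :+ c) :+ (b :+ d)) refl _ _ _ _)

  sumFin-select : ∀ k (f : Fin k → Carrier) i₀ → (∀ i → i ≢ i₀ → f i ≈ 0#) → sumFin k f ≈ f i₀
  sumFin-select (suc k) f Fin.zero      others≈0 =
    trans (+-congˡ (sumFin-zero k (λ i → others≈0 (Fin.suc i) λ ()))) (+-identityʳ _)
  sumFin-select (suc k) f (Fin.suc i₀) others≈0 =
    trans (+-congʳ (others≈0 Fin.zero λ ())) (trans (+-identityˡ _)
      (sumFin-select k (λ i → f (Fin.suc i)) i₀ (λ i i≢i₀ → others≈0 (Fin.suc i) (i≢i₀ ∘ Fin.suc-injective))))

  sumFin-guard : ∀ π k (f : Fin k → Carrier) → sumFin k (λ i → if π then f i else 0#) ≈ (if π then sumFin k f else 0#)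
  sumFin-guard true  k f = refl
  sumFin-guard false k f = sumFin-zero k (λ _ → refl)

  sumFin-indicator : ∀ k c (h : ℕ → Carrier) → c < k ⊎ h c ≈ 0# →
                     sumFin k (λ i → if toℕ i ≡ᵇ c then h (toℕ i) else 0#) ≈ h c
  sumFin-indicator zero    c       h (inj₂ h-c≈0) = sym h-c≈0
  sumFin-indicator (suc k) zero    h _            = trans (+-congˡ (sumFin-zero k (λ _ → refl))) (+-identityʳ _)
  sumFin-indicator (suc k) (suc c) h c<k⊎h-c≈0    =
    trans (+-identityˡ _) (sumFin-indicator k c (λ a → h (suc a)) (⊎.map ℕ.≤-pred (λ h≈0 → h≈0) c<k⊎h-c≈0))

  sumGrid-cong : ∀ m n {f g : Point m n → Carrier} → (∀ p → f p ≈ g p) → sumGrid m n f ≈ sumGrid m n g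
  sumGrid-cong m n f≈g = sumFin-cong m (λ x → sumFin-cong n (λ y → f≈g (x , y)))

  private
    distance≡ᵇ0 : ∀ a c → (∣ a - c ∣ ≡ᵇ 0) ≡ (a ≡ᵇ c)
    distance≡ᵇ0 zero    zero    = ≡.refl
    distance≡ᵇ0 zero    (suc c) = ≡.refl
    distance≡ᵇ0 (suc a) zero    = ≡.refl
    distance≡ᵇ0 (suc a) (suc c) = distance≡ᵇ0 a c

    distance≡ᵇ1 : ∀ a c u → (if ∣ a - c ∣ ≡ᵇ 1 then u else 0#)
                            ≈ (if suc a ≡ᵇ c then u else 0#) + (if a ≡ᵇ suc c then u else 0#)
    distance≡ᵇ1 zero          zero          u = sym (+-identityʳ 0#)
    distance≡ᵇ1 zero          (suc zero)    u = sym (+-identityʳ u)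
    distance≡ᵇ1 zero          (suc (suc c)) u = sym (+-identityʳ 0#)
    distance≡ᵇ1 (suc zero)    zero          u = sym (+-identityˡ u)
    distance≡ᵇ1 (suc (suc a)) zero          u = sym (+-identityˡ 0#)
    distance≡ᵇ1 (suc a)       (suc c)       u = distance≡ᵇ1 a c u

    sum≡ᵇ1 : ∀ e e′ u → (if e ℕ.+ e′ ≡ᵇ 1 then u else 0#)
                        ≈ (if e ≡ᵇ 0 then (if e′ ≡ᵇ 1 then u else 0#) else 0#)
                          + (if e ≡ᵇ 1 then (if e′ ≡ᵇ 0 then u else 0#) else 0#)
    sum≡ᵇ1 zero          zero           u = sym (+-identityʳ 0#)
    sum≡ᵇ1 zero          (suc zero)     u = sym (+-identityʳ u)
    sum≡ᵇ1 zero          (suc (suc e′)) u = sym (+-identityʳ 0#)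
    sum≡ᵇ1 (suc zero)    zero           u = sym (+-identityˡ u)
    sum≡ᵇ1 (suc zero)    (suc e′)       u = sym (+-identityˡ 0#)
    sum≡ᵇ1 (suc (suc e)) e′             u = sym (+-identityˡ 0#)

  sum-at : ∀ k c (h : ℕ → Carrier) → c < k → sumFin k (λ i → if ∣ toℕ i - c ∣ ≡ᵇ 0 then h (toℕ i) else 0#) ≈ h c
  sum-at k c h c<k = trans (sumFin-cong k (λ i → reflexive (cong (λ π → if π then h (toℕ i) else 0#) (distance≡ᵇ0 (toℕ i) c))))
                           (sumFin-indicator k c h (inj₁ c<k))

  sum-beside : ∀ k c (h : ℕ → Carrier) → c < k → h 0 ≈ 0# → h (suc k) ≈ 0# →
    sumFin k (λ i → if ∣ toℕ i - c ∣ ≡ᵇ 1 then h (suc (toℕ i)) else 0#) ≈ h c + h (suc (suc c))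
  sum-beside k c h c<k h-0 h-k = begin
    sumFin k (λ i → if ∣ toℕ i - c ∣ ≡ᵇ 1 then h (suc (toℕ i)) else 0#)
      ≈⟨ sumFin-cong k (λ i → distance≡ᵇ1 (toℕ i) c _) ⟩
    sumFin k (λ i → (if suc (toℕ i) ≡ᵇ c then h (suc (toℕ i)) else 0#) + (if toℕ i ≡ᵇ suc c then h (suc (toℕ i)) else 0#))
      ≈⟨ sumFin-+ k _ _ ⟩
    sumFin k (λ i → if suc (toℕ i) ≡ᵇ c then h (suc (toℕ i)) else 0#)
      + sumFin k (λ i → if toℕ i ≡ᵇ suc c then h (suc (toℕ i)) else 0#)
      ≈⟨ +-cong (before c c<k) (sumFin-indicator k (suc c) (λ a → h (suc a)) after) ⟩
    h c + h (suc (suc c)) ∎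
    where
    before : ∀ c → c < k → sumFin k (λ i → if suc (toℕ i) ≡ᵇ c then h (suc (toℕ i)) else 0#) ≈ h c
    before zero    _     = trans (sumFin-zero k (λ _ → refl)) (sym h-0)
    before (suc c) 1+c<k = sumFin-indicator k c (λ a → h (suc a)) (inj₁ (ℕ.<-trans (ℕ.n<1+n c) 1+c<k))
    after : suc c < k ⊎ h (suc (suc c)) ≈ 0#
    after with ℕ.m≤n⇒m<n∨m≡n c<k
    ... | inj₁ 1+c<k  = inj₁ 1+c<k
    ... | inj₂ ≡.refl = inj₂ h-k

  column-sum : ∀ {n} (ψ : ℕ → Carrier) → ψ 0 ≈ 0# → ψ (suc n) ≈ 0# → ∀ δ (y₀ : Fin n) →
    sumFin n (λ b → if δ ℕ.+ ∣ toℕ b - toℕ y₀ ∣ ≡ᵇ 1 then ψ (suc (toℕ b)) else 0#)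
      ≈ (if δ ≡ᵇ 0 then ψ (toℕ y₀) + ψ (suc (suc (toℕ y₀))) else 0#) + (if δ ≡ᵇ 1 then ψ (suc (toℕ y₀)) else 0#)
  column-sum {n} ψ ψ-0 ψ-n δ y₀ = begin
    sumFin n (λ b → if δ ℕ.+ ∣ toℕ b - y ∣ ≡ᵇ 1 then ψ (suc (toℕ b)) else 0#)
      ≈⟨ trans (sumFin-cong n (λ b → sum≡ᵇ1 δ ∣ toℕ b - y ∣ _)) (sumFin-+ n _ _) ⟩
    sumFin n (λ b → if δ ≡ᵇ 0 then (if ∣ toℕ b - y ∣ ≡ᵇ 1 then ψ (suc (toℕ b)) else 0#) else 0#)
      + sumFin n (λ b → if δ ≡ᵇ 1 then (if ∣ toℕ b - y ∣ ≡ᵇ 0 then ψ (suc (toℕ b)) else 0#) else 0#)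
      ≈⟨ +-cong (trans (sumFin-guard _ n _) (if-cong (δ ≡ᵇ 0) (sum-beside n y ψ (Fin.toℕ<n y₀) ψ-0 ψ-n)))
                (trans (sumFin-guard _ n _) (if-cong (δ ≡ᵇ 1) (sum-at n y (ψ ∘ suc) (Fin.toℕ<n y₀)))) ⟩
    (if δ ≡ᵇ 0 then ψ y + ψ (suc (suc y)) else 0#) + (if δ ≡ᵇ 1 then ψ (suc y) else 0#) ∎
    where y = toℕ y₀

  adjacency-sum : ∀ {m n} (φ : ℕ → ℕ → Carrier) → VanishesOnFrame (suc m) (suc n) φ → ∀ x₀ y₀ →
    sumGrid m n (λ p → if adjacent p (x₀ , y₀) then φ (suc (toℕ (proj₁ p))) (suc (toℕ (proj₂ p))) else 0#)
      ≈ neighbourSum φ (toℕ x₀) (toℕ y₀)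
  adjacency-sum {m} {n} φ φ-frame x₀ y₀ = begin
    sumFin m (λ a → sumFin n (λ b → if ∣ toℕ a - x ∣ ℕ.+ ∣ toℕ b - y ∣ ≡ᵇ 1 then φ (suc (toℕ a)) (suc (toℕ b)) else 0#))
      ≈⟨ sumFin-cong m (λ a → column-sum (φ (suc (toℕ a))) (bottom _) (top _) ∣ toℕ a - x ∣ y₀) ⟩
    sumFin m (λ a → (if ∣ toℕ a - x ∣ ≡ᵇ 0 then φ (suc (toℕ a)) y + φ (suc (toℕ a)) (suc (suc y)) else 0#)
                  + (if ∣ toℕ a - x ∣ ≡ᵇ 1 then φ (suc (toℕ a)) (suc y) else 0#))
      ≈⟨ sumFin-+ m _ _ ⟩
    sumFin m (λ a → if ∣ toℕ a - x ∣ ≡ᵇ 0 then φ (suc (toℕ a)) y + φ (suc (toℕ a)) (suc (suc y)) else 0#)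
      + sumFin m (λ a → if ∣ toℕ a - x ∣ ≡ᵇ 1 then φ (suc (toℕ a)) (suc y) else 0#)
      ≈⟨ +-cong (sum-at m x (λ A → φ (suc A) y + φ (suc A) (suc (suc y))) (Fin.toℕ<n x₀))
                (sum-beside m x (λ A → φ A (suc y)) (Fin.toℕ<n x₀) (left _) (right _)) ⟩
    (φ (suc x) y + φ (suc x) (suc (suc y))) + (φ x (suc y) + φ (suc (suc x)) (suc y))
      ≈⟨ solve 4 (λ a b c d → (a :+ b) :+ (c :+ d) := ((c :+ d) :+ a) :+ b) refl _ _ _ _ ⟩
    neighbourSum φ x y ∎
    where
    open VanishesOnFrame φ-frame
    x = toℕ x₀
    y = toℕ y₀

  module Residual {k : ℕ} (a : Fin k → Carrier) (φ : ℕ → ℕ → Carrier) (F : Fin k → ℕ → ℕ → Carrier) where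

    residual : ℕ → ℕ → Carrier
    residual X Y = φ X Y - sumFin k (λ i → a i * F i X Y)

    residual-zero : ∀ X Y → φ X Y ≈ 0# → (∀ i → F i X Y ≈ 0#) → residual X Y ≈ 0#
    residual-zero X Y φ≈0 F≈0 = begin
      φ X Y - sumFin k (λ i → a i * F i X Y)   ≈⟨ +-cong φ≈0 (-‿cong (sumFin-zero k (λ i → trans (*-congˡ (F≈0 i)) (zeroʳ (a i))))) ⟩
      0# - 0#                                  ≈⟨ -‿inverseʳ 0# ⟩
      0#                                       ∎

    neighbourSum-residual : ∀ x y → neighbourSum residual x y
      ≈ neighbourSum φ x y - sumFin k (λ i → a i * neighbourSum (F i) x y)
    neighbourSum-residual x y = begin
      neighbourSum residual x y
        ≈⟨ solve 8 (λ φ₁ s₁ φ₂ s₂ φ₃ s₃ φ₄ s₄ → (((φ₁ :- s₁) :+ (φ₂ :- s₂)) :+ (φ₃ :- s₃)) :+ (φ₄ :- s₄)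
                      := (((φ₁ :+ φ₂) :+ φ₃) :+ φ₄) :- (((s₁ :+ s₂) :+ s₃) :+ s₄)) refl _ _ _ _ _ _ _ _ ⟩
      neighbourSum φ x y - (((weighted (λ i → F i x (suc y)) + weighted (λ i → F i (suc (suc x)) (suc y)))
                              + weighted (λ i → F i (suc x) y)) + weighted (λ i → F i (suc x) (suc (suc y))))
        ≈⟨ +-congˡ (-‿cong (sym (trans (sumFin-cong k (λ i → distribute (a i) _ _ _ _))
                                       (trans (sumFin-+ k _ _) (+-congʳ (trans (sumFin-+ k _ _) (+-congʳ (sumFin-+ k _ _)))))))) ⟩
      neighbourSum φ x y - sumFin k (λ i → a i * neighbourSum (F i) x y) ∎
      where
      weighted : (Fin k → Carrier) → Carrier
      weighted f = sumFin k (λ i → a i * f i)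
      distribute : ∀ a u v w t → a * (((u + v) + w) + t) ≈ ((a * u + a * v) + a * w) + a * t
      distribute = solve 5 (λ a u v w t → a :* (((u :+ v) :+ w) :+ t) := ((a :* u :+ a :* v) :+ a :* w) :+ a :* t) refl

  frame : ∀ {m n} → (Point m n → Carrier) → ℕ → ℕ → Carrier
  frame         f zero    _       = 0#
  frame         f (suc x) zero    = 0#
  frame {m} {n} f (suc x) (suc y) with x <? m | y <? n
  ... | yes x<m | yes y<n = f (fromℕ< x<m , fromℕ< y<n)
  ... | _       | _       = 0#

  module _ {m n : ℕ} (f : Point m n → Carrier) where

    frame-at : ∀ x y → frame f (suc (toℕ x)) (suc (toℕ y)) ≈ f (x , y)
    frame-at x y with toℕ x <? m | toℕ y <? n
    ... | yes x<m | yes y<n = reflexive (cong₂ (λ a b → f (a , b)) (Fin.fromℕ<-toℕ x x<m) (Fin.fromℕ<-toℕ y y<n))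
    ... | no  x≮m | _       = contradiction (Fin.toℕ<n x) x≮m
    ... | yes _   | no  y≮n = contradiction (Fin.toℕ<n y) y≮n

    frame-zero : ∀ x y → (∀ (x<m : x < m) (y<n : y < n) → f (fromℕ< x<m , fromℕ< y<n) ≈ 0#) →
                 frame f (suc x) (suc y) ≈ 0#
    frame-zero x y f≈0 with x <? m | y <? n
    ... | yes x<m | yes y<n = f≈0 x<m y<n
    ... | yes _   | no  _   = refl
    ... | no  _   | _       = refl

    frame-vanishes : VanishesOnFrame (suc m) (suc n) (frame f)
    frame-vanishes = record { left = λ _ → refl ; bottom = bottom ; right = right ; top = top }
      where
      bottom : ∀ X → frame f X 0 ≈ 0#
      bottom zero    = refl
      bottom (suc _) = refl
      right : ∀ Y → frame f (suc m) Y ≈ 0#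
      right zero = refl
      right (suc y) with m <? m | y <? n
      ... | yes m<m | yes _ = contradiction m<m (ℕ.<-irrefl ≡.refl)
      ... | yes _   | no  _ = refl
      ... | no  _   | _     = refl
      top : ∀ X → frame f X (suc n) ≈ 0#
      top zero = refl
      top (suc x) with x <? m | n <? n
      ... | yes _ | yes n<n = contradiction n<n (ℕ.<-irrefl ≡.refl)
      ... | yes _ | no  _   = refl
      ... | no  _ | _       = refl

module ColourClass {c ℓ : Level} (K : Field c ℓ) where
  open Field K
  open Linear K
  open import Data.Product using (_×_)
  open import Algebra.Properties.AbelianGroup +-abelianGroup using (x∙y⁻¹≈ε⇒x≈y)
  open import Relation.Binary.Reasoning.Setoid setoid
  open HarmonicFunctions commutativeRing
  open StandingWaves commutativeRing
  open GridSums K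

  module _ {m n : ℕ} (e : ℕ) (col : Point m n → Bool)
           (col-parity : ∀ x y → col (x , y) ≡ even (toℕ x ℕ.+ toℕ y ℕ.+ e))
           (ext : (Σ (Point m n) (λ p → T (col p)) → Carrier) → Point m n → Carrier)
           (ext-yes : ∀ v p (t : T (col p)) → ext v p ≈ v (p , t))
           (ext-no : ∀ v p → col p ≡ false → ext v p ≈ 0#)
           {k : ℕ} (indexing : BandIndexing e (gcd (suc m) (suc n)) k) where

    open BandIndexing indexing

    private
      d : ℕ
      d = gcd (suc m) (suc n)

      instance
        d-nonZero : NonZero d
        d-nonZero = ℕ.≢-nonZero (gcd[m,n]≢0 (suc m) (suc n) (inj₁ λ ()))

      parity-shift : ∀ x y → even (suc x ℕ.+ suc y ℕ.+ e) ≡ even (x ℕ.+ y ℕ.+ e)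
      parity-shift x y = cong (λ t → even (suc t ℕ.+ e)) (ℕ.+-suc x y)

    Source : Set
    Source = Σ (Point m n) (λ p → T (col p))

    Op : (Source → Carrier) → Point m n → Carrier
    Op v w = sumGrid m n (λ p → if adjacent p w then ext v p else 0#)

    InKernel : (Source → Carrier) → Set ℓ
    InKernel v = ∀ w → col w ≡ false → Op v w ≈ 0#

    op-neighbourSum : ∀ v φ → VanishesOnFrame (suc m) (suc n) φ →
      (∀ x y → ext v (x , y) ≈ φ (suc (toℕ x)) (suc (toℕ y))) →
      ∀ x₀ y₀ → Op v (x₀ , y₀) ≈ neighbourSum φ (toℕ x₀) (toℕ y₀)
    op-neighbourSum v φ φ-frame ext≈φ x₀ y₀ =
      trans (sumGrid-cong m n (λ p → if-cong (adjacent p (x₀ , y₀)) (ext≈φ (proj₁ p) (proj₂ p))))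
            (adjacency-sum φ φ-frame x₀ y₀)

    module Basis (i : Fin k) = BandWave e d (index i) (index-parity i)
    open Basis using (bandWave; bandWave-harmonic; bandWave-frame; bandWave-supported; bandWave-values;
                      bandWave-row-diagonal; bandWave-row-off)

    basis : Fin k → Source → Carrier
    basis i ((x , y) , _) = bandWave i (suc (toℕ x)) (suc (toℕ y))

    basis-frame : ∀ i → VanishesOnFrame (suc m) (suc n) (bandWave i)
    basis-frame i = bandWave-frame i (gcd[m,n]∣m (suc m) (suc n)) (gcd[m,n]∣n (suc m) (suc n))

    basis-ext : ∀ i x y → ext (basis i) (x , y) ≈ bandWave i (suc (toℕ x)) (suc (toℕ y))
    basis-ext i x y with col (x , y) in col-xy
    ... | true  = ext-yes (basis i) (x , y) (≡.subst T (≡.sym col-xy) _)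
    ... | false = trans (ext-no (basis i) (x , y) col-xy)
                        (sym (bandWave-supported i (suc (toℕ x)) (suc (toℕ y))
                               (≡.trans (parity-shift (toℕ x) (toℕ y)) (≡.trans (≡.sym (col-parity x y)) col-xy))))

    basis-in-kernel : ∀ i → InKernel (basis i)
    basis-in-kernel i (x₀ , y₀) _ =
      trans (op-neighbourSum (basis i) (bandWave i) (basis-frame i) (basis-ext i) x₀ y₀) (bandWave-harmonic i (toℕ x₀) (toℕ y₀))

    basis-signs : ∀ i s → basis i s ≈ 0# ⊎ basis i s ≈ 1# ⊎ basis i s ≈ - 1#
    basis-signs i ((x , y) , _) = bandWave-values i (suc (toℕ x)) (suc (toℕ y))

    row-combination : ∀ (a : Fin k → Carrier) i₀ → sumFin k (λ i → a i * bandWave i (suc (index i₀)) 1) ≈ a i₀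
    row-combination a i₀ = trans
      (sumFin-select k _ i₀ (λ i i≢i₀ →
        trans (*-congˡ (bandWave-row-off i (index-bound i₀) (λ same → i≢i₀ (index-injective (≡.sym same))))) (zeroʳ (a i))))
      (trans (*-congˡ (bandWave-row-diagonal i₀ (index-bound i₀))) (*-identityʳ (a i₀)))

    basis-independent : LinIndep basis
    basis-independent a combination≈0 i₀ = begin
      a i₀                                                          ≈⟨ row-combination a i₀ ⟨
      sumFin k (λ i → a i * bandWave i (suc (index i₀)) 1)          ≡⟨ cong₂ (λ X Y → sumFin k (λ i → a i * bandWave i (suc X) (suc Y)))
                                                                              (Fin.toℕ-fromℕ< i₀<m) (Fin.toℕ-fromℕ< 0<n) ⟨
      linComb a basis s₀                                            ≈⟨ combination≈0 s₀ ⟩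
      0#                                                            ∎
      where
      2+i₀≤1+n = ℕ.≤-trans (index-bound i₀) (∣⇒≤ (gcd[m,n]∣n (suc m) (suc n)))
      i₀<m = ℕ.≤-pred (ℕ.≤-trans (index-bound i₀) (∣⇒≤ (gcd[m,n]∣m (suc m) (suc n))))
      0<n = ℕ.≤-trans (s≤s z≤n) (ℕ.≤-pred 2+i₀≤1+n)
      x₀ = fromℕ< i₀<m
      y₀ = fromℕ< 0<n
      s₀ : Source
      s₀ = (x₀ , y₀) , ≡.subst T (≡.sym (≡.trans (col-parity x₀ y₀)
             (≡.trans (cong₂ (λ X Y → even (X ℕ.+ Y ℕ.+ e)) (Fin.toℕ-fromℕ< i₀<m) (Fin.toℕ-fromℕ< 0<n))
                      (≡.trans (cong (λ X → even (X ℕ.+ e)) (ℕ.+-identityʳ (index i₀))) (index-parity i₀))))) _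

    module Spanning (v : Source → Carrier) (v-kernel : InKernel v) where

      φ : ℕ → ℕ → Carrier
      φ = frame (ext v)

      ext≈φ : ∀ x y → ext v (x , y) ≈ φ (suc (toℕ x)) (suc (toℕ y))
      ext≈φ x y = sym (frame-at (ext v) x y)

      φ-supported : Supported e φ
      φ-supported zero    _       _   = refl
      φ-supported (suc x) zero    _   = refl
      φ-supported (suc x) (suc y) odd = frame-zero (ext v) x y (λ x<m y<n → ext-no v _
        (≡.trans (col-parity _ _) (≡.trans (cong₂ (λ X Y → even (X ℕ.+ Y ℕ.+ e)) (Fin.toℕ-fromℕ< x<m) (Fin.toℕ-fromℕ< y<n))
                                           (≡.trans (≡.sym (parity-shift x y)) odd))))

      φ-harmonic : IsHarmonic m n φ
      φ-harmonic x y x<m y<n with col w in col-w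
        where w = (fromℕ< x<m , fromℕ< y<n)
      ... | false = begin
        neighbourSum φ x y                ≡⟨ cong₂ (neighbourSum φ) (Fin.toℕ-fromℕ< x<m) (Fin.toℕ-fromℕ< y<n) ⟨
        neighbourSum φ (toℕ x₀) (toℕ y₀)  ≈⟨ op-neighbourSum v φ (frame-vanishes (ext v)) ext≈φ x₀ y₀ ⟨
        Op v (x₀ , y₀)                    ≈⟨ v-kernel (x₀ , y₀) col-w ⟩
        0#                                ∎
        where x₀ = fromℕ< x<m; y₀ = fromℕ< y<n
      ... | true  = supported-neighbourSum φ-supported x y
        (≡.trans (≡.sym (cong₂ (λ X Y → even (X ℕ.+ Y ℕ.+ e)) (Fin.toℕ-fromℕ< x<m) (Fin.toℕ-fromℕ< y<n)))
                 (≡.trans (≡.sym (col-parity _ _)) col-w))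

      coefficient : Fin k → Carrier
      coefficient i = φ (suc (index i)) 1

      open Residual coefficient φ bandWave

      residual-frame : VanishesOnFrame (suc m) (suc n) residual
      residual-frame = record
        { left   = λ Y → residual-zero 0 Y (left φ-frame Y) (λ i → left (basis-frame i) Y)
        ; bottom = λ X → residual-zero X 0 (bottom φ-frame X) (λ i → bottom (basis-frame i) X)
        ; right  = λ Y → residual-zero (suc m) Y (right φ-frame Y) (λ i → right (basis-frame i) Y)
        ; top    = λ X → residual-zero X (suc n) (top φ-frame X) (λ i → top (basis-frame i) X)
        }
        where
        open VanishesOnFrame
        φ-frame = frame-vanishes (ext v)

      residual-harmonic : IsHarmonic m n residual
      residual-harmonic x y x<m y<n = begin
        neighbourSum residual x y                                            ≈⟨ neighbourSum-residual x y ⟩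
        neighbourSum φ x y - sumFin k (λ i → coefficient i * neighbourSum (bandWave i) x y)
          ≈⟨ +-cong (φ-harmonic x y x<m y<n)
                    (-‿cong (sumFin-zero k (λ i → trans (*-congˡ (bandWave-harmonic i x y)) (zeroʳ _)))) ⟩
        0# - 0#                                                              ≈⟨ -‿inverseʳ 0# ⟩
        0#                                                                   ∎

      residual-row : ∀ x → suc x < d → residual (suc x) 1 ≈ 0#
      residual-row x 1+x<d with even (x ℕ.+ e) in x-parity
      ... | true with index-surjective x 1+x<d x-parity
      ...   | i₀ , ≡.refl = trans (+-congˡ (-‿cong (row-combination coefficient i₀))) (-‿inverseʳ _)
      residual-row x 1+x<d | false = residual-zero (suc x) 1
        (φ-supported (suc x) 1 (≡.trans (cong (λ t → even (suc t ℕ.+ e)) (ℕ.+-comm x 1)) x-parity))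
        (λ i → bandWave-row-off i 1+x<d λ { ≡.refl → contradiction (≡.trans (≡.sym (index-parity i)) x-parity) λ () })

      spans : ∀ s → v s ≈ linComb coefficient basis s
      spans ((x , y) , t) = begin
        v ((x , y) , t)                 ≈⟨ ext-yes v (x , y) t ⟨
        ext v (x , y)                   ≈⟨ ext≈φ x y ⟩
        φ (suc (toℕ x)) (suc (toℕ y))   ≈⟨ x∙y⁻¹≈ε⇒x≈y _ _ (harmonic-vanishing residual-frame residual-harmonic residual-row
                                             _ _ (s≤s (ℕ.<⇒≤ (Fin.toℕ<n x))) (s≤s (ℕ.<⇒≤ (Fin.toℕ<n y)))) ⟩
        linComb coefficient basis ((x , y) , t) ∎

    kernel-basis : ∀ {ℓ′} (S : (Source → Carrier) → Set ℓ′) → (∀ v → S v → InKernel v) → (∀ v → InKernel v → S v) →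
                   HasDim S k × HasSignBasis S
    kernel-basis S S⇒kernel kernel⇒S = (basis , is-basis) , (k , basis , is-basis , basis-signs)
      where
      is-basis : IsBasis S basis
      is-basis = (λ i → kernel⇒S _ (basis-in-kernel i)) , basis-independent ,
                 (λ v v∈S → Spanning.coefficient v (S⇒kernel v v∈S) , Spanning.spans v (S⇒kernel v v∈S))

module Colourings {c ℓ : Level} (K : Field c ℓ) {m n : ℕ} where
  open Field K
  open Linear K

  extB-yes : ∀ (v : BlackPt m n → Carrier) p (t : T (isBlack p)) → extB v p ≈ v (p , t)
  extB-yes v p t with T? (isBlack p)
  ... | yes t′ = reflexive (cong (λ s → v (p , s)) (T-irrelevant t′ t))
  ... | no  ¬t = contradiction t ¬t

  extB-no : ∀ (v : BlackPt m n → Carrier) p → isBlack p ≡ false → extB v p ≈ 0#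
  extB-no v p white with T? (isBlack p)
  ... | yes t = ⊥-elim (≡.subst T white t)
  ... | no  _ = refl

  extW-yes : ∀ (v : WhitePt m n → Carrier) p (t : T (not (isBlack p))) → extW v p ≈ v (p , t)
  extW-yes v p t with T? (not (isBlack p))
  ... | yes t′ = reflexive (cong (λ s → v (p , s)) (T-irrelevant t′ t))
  ... | no  ¬t = contradiction t ¬t

  extW-no : ∀ (v : WhitePt m n → Carrier) p → not (isBlack p) ≡ false → extW v p ≈ 0#
  extW-no v p black with T? (not (isBlack p))
  ... | yes t = ⊥-elim (≡.subst T black t)
  ... | no  _ = refl

  black-parity : ∀ (x : Fin m) (y : Fin n) → isBlack (x , y) ≡ even (toℕ x ℕ.+ toℕ y ℕ.+ 0)
  black-parity x y = cong even (≡.sym (ℕ.+-identityʳ (toℕ x ℕ.+ toℕ y)))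

  white-parity : ∀ (x : Fin m) (y : Fin n) → not (isBlack (x , y)) ≡ even (toℕ x ℕ.+ toℕ y ℕ.+ 1)
  white-parity x y = ≡.sym (≡.trans (cong even (ℕ.+-comm (toℕ x ℕ.+ toℕ y) 1)) (even-suc (toℕ x ℕ.+ toℕ y)))

open import Data.Nat using (_+_; _∸_)
open import Data.Product using (_×_)

theorem1 : ∀ {c ℓ : Level} (K : Field c ℓ) (m n : ℕ) → 1 ≤ m → 1 ≤ n →
    let open Linear K
        cc = gcd (m + 1) (n + 1) ∸ 1
    in HasDim (KerBW {m} {n}) ⌈ cc /2⌉
       × HasDim (KerWB {m} {n}) ⌊ cc /2⌋
       × HasSignBasis (KerBW {m} {n})
       × HasSignBasis (KerWB {m} {n})
theorem1 K m n _ _ rewrite ℕ.+-comm m 1 | ℕ.+-comm n 1 =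
  proj₁ black , proj₁ white , proj₂ black , proj₂ white
  where
  open Linear K
  open Colourings K {m} {n}
  open ColourClass K using (kernel-basis)
  d = gcd (suc m) (suc n)
  [d∸1]+1≡d : suc (d ∸ 1) ≡ d
  [d∸1]+1≡d = ≡.trans (ℕ.+-comm 1 (d ∸ 1)) (ℕ.m∸n+n≡m (ℕ.n≢0⇒n>0 (gcd[m,n]≢0 (suc m) (suc n) (inj₁ λ ()))))
  black = kernel-basis 0 isBlack black-parity extB extB-yes extB-no
            (bandIndexing z≤n (≡.trans (ℕ.+-identityʳ _) [d∸1]+1≡d)) KerBW
            (λ v v∈ker w w-white → v∈ker (w , Equivalence.from T-not-≡ w-white))
            (λ v v∈ker (w , t) → v∈ker w (Equivalence.to T-not-≡ t))
  white = kernel-basis 1 (λ p → not (isBlack p)) white-parity extW extW-yes extW-no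
            (bandIndexing (s≤s z≤n) (≡.trans (ℕ.+-comm (d ∸ 1) 1) [d∸1]+1≡d)) KerWB
            (λ v v∈ker w w-black → v∈ker (w , Equivalence.from T-≡ (not-injective w-black)))
            (λ v v∈ker (w , t) → v∈ker w (≡.cong not (Equivalence.to T-≡ t)))
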